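{- Let $k\geq 2$ be an integer. Call a word $w=w_1\cdots w_n\in[k]^n$ (where $[k]=\{1,\ldots,k\}$) Hertzsprung if there is no $1\leq i\leq n-1$ with $|w_{i+1}-w_i|\leq 1$. Then the generating function $\sum_{n\geq 0} h_n x^n$, where $h_n$ is the number of Hertzsprung words in $[k]^n$, equals \[\left(1-\frac{kx}{1+3x}-\frac{2x^{2}}{(1+3x)^{2}}\cdot\frac{U_{k}\left(-\frac{1+x}{2x}\right)-U_{k-1}\left(-\frac{1+x}{2x}\right)-1}{U_{k}\left(-\frac{1+x}{2x}\right)}\right)^{ -1}.\]
   Context: $U_n(y)$ denotes the Chebyshev polynomial of the second kind, defined by $U_0(y)=1$, $U_1(y)=2y$, $U_{n+1}(y)=2yU_n(y)-U_{n-1}(y)$. The empty word and all words of length $1$ are Hertzsprung. -}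

module Defs where

open import Data.Nat as ℕ using (ℕ; zero; suc; ∣_-_∣; _≤ᵇ_)
open import Data.Integer as ℤ using (ℤ; +_; -_)
open import Data.Fin using (Fin; toℕ)
open import Data.Vec using (Vec; []; _∷_)
open import Data.List using (List; []; _∷_; [_]; map; concatMap; allFin; filterᵇ; length; upTo; foldr)
open import Data.Bool using (Bool; true; false; _∧_; not)
open import Data.Product using (_×_; _,_; proj₁; proj₂)

-- Words over the alphabet [k] = {1,…,k}, represented by Fin k
-- (letter i ∈ [k] ↔ Fin element i-1; differences are unaffected).

hertzsprung : ∀ {k n} → Vec (Fin k) n → Bool
hertzsprung [] = true
hertzsprung (a ∷ []) = true
hertzsprung (a ∷ b ∷ w) = not (∣ toℕ b - toℕ a ∣ ≤ᵇ 1) ∧ hertzsprung (b ∷ w)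

allWords : (k n : ℕ) → List (Vec (Fin k) n)
allWords k zero = [ [] ]
allWords k (suc n) = concatMap (λ a → map (a ∷_) (allWords k n)) (allFin k)

h : (k n : ℕ) → ℕ
h k n = length (filterᵇ hertzsprung (allWords k n))

-- Polynomials over ℤ as coefficient lists (lowest degree first).

Poly : Set
Poly = List ℤ

coeff : Poly → ℕ → ℤ
coeff [] _ = + 0
coeff (a ∷ p) zero = a
coeff (a ∷ p) (suc i) = coeff p i

_⊕_ : Poly → Poly → Poly
[] ⊕ q = q
(a ∷ p) ⊕ [] = a ∷ p
(a ∷ p) ⊕ (b ∷ q) = (a ℤ.+ b) ∷ (p ⊕ q)

scale : ℤ → Poly → Poly
scale c = map (c ℤ.*_)

_⊗_ : Poly → Poly → Poly
[] ⊗ q = []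
(a ∷ p) ⊗ q = scale a q ⊕ (+ 0 ∷ (p ⊗ q))

-- Rational functions as formal fractions (numerator , denominator).
-- Denominators are never cancelled, so the final denominator is the
-- product of every denominator (and every divisor) used: it is a nonzero
-- polynomial iff all divisions in the expression are legitimate.

Frac : Set
Frac = Poly × Poly

cst : ℤ → Frac
cst c = (c ∷ []) , (+ 1 ∷ [])

X : Frac
X = (+ 0 ∷ + 1 ∷ []) , (+ 1 ∷ [])

_+f_ : Frac → Frac → Frac
(a , b) +f (c , d) = ((a ⊗ d) ⊕ (c ⊗ b)) , (b ⊗ d)

_*f_ : Frac → Frac → Frac
(a , b) *f (c , d) = (a ⊗ c) , (b ⊗ d)

negf : Frac → Frac
negf (a , b) = scale (- + 1) a , b

_-f_ : Frac → Frac → Frac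
p -f q = p +f negf q

invf : Frac → Frac
invf (a , b) = b , a

_/f_ : Frac → Frac → Frac
p /f q = p *f invf q

-- Chebyshev polynomials of the second kind evaluated at a rational
-- function y: returns (U_n(y) , U_{n+1}(y)).
Upair : Frac → ℕ → Frac × Frac
Upair y zero = cst (+ 1) , (cst (+ 2) *f y)
Upair y (suc n) with Upair y n
... | (u₀ , u₁) = u₁ , (((cst (+ 2) *f y) *f u₁) -f u₀)

U : ℕ → Frac → Frac
U n y = proj₁ (Upair y n)

yArg : Frac
yArg = negf (cst (+ 1) +f X) /f (cst (+ 2) *f X)

-- The right-hand side of the theorem, for a given k (k ≥ 2, so k-1 = pred k).
rhs : ℕ → Frac
rhs k =
  invf ( (cst (+ 1)
          -f ((cst (+ k) *f X) /f A))
          -f (((cst (+ 2) *f (X *f X)) /f (A *f A))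
               *f (((U k yArg -f U (ℕ.pred k) yArg) -f cst (+ 1)) /f U k yArg)) )
  where
  A : Frac
  A = cst (+ 1) +f (cst (+ 3) *f X)

sumℤ : List ℤ → ℤ
sumℤ = foldr ℤ._+_ (+ 0)

convCoeff : Poly → (ℕ → ℤ) → ℕ → ℤ
convCoeff D f n = sumℤ (map (λ j → coeff D j ℤ.* f (n ℕ.∸ j)) (upTo (suc n)))

-- Let gₐ be the generating function of the Hertzsprung words with first letter a (so g₀ = gₖ₊₁ = 0)
-- and H that of all Hertzsprung words. Deleting the first letter of a word gives
-- x gₐ₋₁ + (1 + x) gₐ + x gₐ₊₁ = x H for every letter a, and summing over a, using the symmetry
-- g₁ = gₖ that comes from reversing the alphabet, gives (1 + 3x) (H − 1) = k x H + 2x g₁.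
-- The three-term recurrence is solved by Chebyshev polynomials: with uⱼ = xʲ⁻¹ Uⱼ₋₁(−(1+x)/(2x)),
-- xʲ gⱼ = x uⱼ g₁ + bⱼ H where (1 + 3x) bⱼ = xʲ⁺¹ − x² uⱼ + x³ uⱼ₋₁, so gₖ₊₁ = 0 determines g₁
-- and hence H. All denominators involved are nonzero at x = 1, where uⱼ = ±j.
module Submission where

open import Defs
open import Algebra.Bundles using (CommutativeRing)
open import Data.Bool using (Bool; true; false; if_then_else_; _∧_; not)
open import Data.Bool.Properties using (T-≡)
open import Data.Empty using (⊥-elim)
open import Data.Fin as Fin using (Fin; toℕ)
open import Data.Fin.Properties using (toℕ<n; toℕ-inject₁; toℕ-fromℕ)
open import Data.Integer.Properties as ℤ using ()
open import Algebra.Properties.CommutativeMonoid.Sum ℤ.+-0-commutativeMonoid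
  using (sum; ∑-distrib-+; sum-cong-≗; sum-init-last; sum-replicate-zero)
open import Data.Integer.Tactic.RingSolver as ℤ-Solver using ()
open import Data.List using (List; []; _∷_; _++_; map; applyUpTo; upTo; concatMap; tabulate; filterᵇ; length)
open import Data.List.Properties using (map-cong; map-applyUpTo; filter-++; length-++)
open import Data.Maybe using (Maybe; just; nothing)
open import Data.Nat as ℕ using (ℕ; zero; suc; _≤_; _∸_; ∣_-_∣; _≤ᵇ_)
open import Data.Nat.Properties as ℕ using ()
open import Data.Product using (Σ; _×_; _,_; proj₁; proj₂)
open import Data.Sum using (_⊎_; inj₁; inj₂)
open import Data.Vec using () renaming (_∷_ to _∷ᵥ_)
open import Function using (_∘_)
open import Function.Bundles using (Equivalence)
open import Level using (0ℓ)
open import Relation.Binary.Bundles using (Setoid)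
open import Relation.Binary.Structures using (IsEquivalence)
open import Relation.Binary.PropositionalEquality using (_≡_; _≢_; refl; sym; trans; cong; cong₂; module ≡-Reasoning)
open import Relation.Nullary using (yes; no)
open import Relation.Nullary.Decidable using (T?)
open import Tactic.RingSolver using (solve-∀)
import Relation.Binary.Reasoning.Setoid as SetoidReasoning
import Tactic.RingSolver.Core.AlmostCommutativeRing as ACR

module LinearCombination {c ℓ} (R : CommutativeRing c ℓ) where
  open CommutativeRing R
  open import Relation.Binary.Reasoning.Setoid setoid

  scaled-difference : ∀ t {x y} → x ≈ y → t * (x - y) ≈ 0#
  scaled-difference t {x} {y} x≈y = begin
    t * (x - y)   ≈⟨ *-congˡ (+-congʳ x≈y) ⟩
    t * (y - y)   ≈⟨ *-congˡ (-‿inverseʳ y) ⟩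
    t * 0#        ≈⟨ zeroʳ t ⟩
    0#            ∎

  linear-combination₃ : ∀ {a b l₁ r₁ l₂ r₂ l₃ r₃} t₁ t₂ t₃ → l₁ ≈ r₁ → l₂ ≈ r₂ → l₃ ≈ r₃ →
    a ≈ b + t₁ * (l₁ - r₁) + t₂ * (l₂ - r₂) + t₃ * (l₃ - r₃) → a ≈ b
  linear-combination₃ {a} {b} t₁ t₂ t₃ e₁ e₂ e₃ a≈ = begin
    a                              ≈⟨ a≈ ⟩
    b + t₁ * _ + t₂ * _ + t₃ * _   ≈⟨ +-cong (+-cong (+-congˡ (scaled-difference t₁ e₁)) (scaled-difference t₂ e₂))
                                             (scaled-difference t₃ e₃) ⟩
    b + 0# + 0# + 0#               ≈⟨ +-identityʳ _ ⟩
    b + 0# + 0#                    ≈⟨ +-identityʳ _ ⟩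
    b + 0#                         ≈⟨ +-identityʳ b ⟩
    b                              ∎

open import Data.Integer as ℤ using (ℤ; +_; -_; _+_; _*_)

-- Power series as a module over polynomials

1ₚ xₚ : Poly
1ₚ = + 1 ∷ []
xₚ = + 0 ∷ 1ₚ

neg : Poly → Poly
neg = scale (- + 1)

Series : Set
Series = ℕ → ℤ

infix 4 _≐_
record _≐_ (f g : Series) : Set where
  constructor pointwise
  field at : ∀ n → f n ≡ g n

open _≐_ public

≐-refl : ∀ {f} → f ≐ f
≐-refl = pointwise λ _ → refl

≐-sym : ∀ {f g} → f ≐ g → g ≐ f
≐-sym e = pointwise λ n → sym (at e n)

≐-trans : ∀ {f g h} → f ≐ g → g ≐ h → f ≐ h
≐-trans e e′ = pointwise λ n → trans (at e n) (at e′ n)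

≐-setoid : Setoid 0ℓ 0ℓ
≐-setoid = record
  { Carrier = Series ; _≈_ = _≐_
  ; isEquivalence = record { refl = ≐-refl ; sym = ≐-sym ; trans = ≐-trans } }

module ≐-Reasoning = SetoidReasoning ≐-setoid

0ₛ : Series
0ₛ _ = + 0

infixl 6 _⊞_
_⊞_ : Series → Series → Series
(f ⊞ g) n = f n + g n

infixr 7 _·_
_·_ : ℤ → Series → Series
(c · f) n = c * f n

shift : Series → Series
shift f zero = + 0
shift f (suc n) = f n

infixr 7 _◃_
_◃_ : Poly → Series → Series
[] ◃ f = 0ₛ
(a ∷ p) ◃ f = a · f ⊞ shift (p ◃ f)

⊞-cong : ∀ {f f′ g g′} → f ≐ f′ → g ≐ g′ → f ⊞ g ≐ f′ ⊞ g′
⊞-cong e e′ = pointwise λ n → cong₂ _+_ (at e n) (at e′ n)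

⊞-congʳ : ∀ {f f′} g → f ≐ f′ → f ⊞ g ≐ f′ ⊞ g
⊞-congʳ g e = ⊞-cong e (≐-refl {g})

⊞-congˡ : ∀ f {g g′} → g ≐ g′ → f ⊞ g ≐ f ⊞ g′
⊞-congˡ f e = ⊞-cong (≐-refl {f}) e

·-congˡ : ∀ c {f g} → f ≐ g → c · f ≐ c · g
·-congˡ c e = pointwise λ n → cong (c *_) (at e n)

shift-cong : ∀ {f g} → f ≐ g → shift f ≐ shift g
shift-cong e = pointwise λ { zero → refl ; (suc n) → at e n }

shift-⊞ : ∀ f g → shift (f ⊞ g) ≐ shift f ⊞ shift g
shift-⊞ f g = pointwise λ { zero → refl ; (suc n) → refl }

shift-· : ∀ c f → shift (c · f) ≐ c · shift f
shift-· c f = pointwise λ { zero → sym (ℤ.*-zeroʳ c) ; (suc n) → refl }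

shift-0ₛ : shift 0ₛ ≐ 0ₛ
shift-0ₛ = pointwise λ { zero → refl ; (suc n) → refl }

coeff-⊕ : ∀ p q → coeff (p ⊕ q) ≐ coeff p ⊞ coeff q
coeff-⊕ p q = pointwise (go p q)
  where
  go : ∀ p q n → coeff (p ⊕ q) n ≡ coeff p n + coeff q n
  go [] q n = sym (ℤ.+-identityˡ _)
  go (a ∷ p) [] n = sym (ℤ.+-identityʳ _)
  go (a ∷ p) (b ∷ q) zero = refl
  go (a ∷ p) (b ∷ q) (suc n) = go p q n

coeff-scale : ∀ c p → coeff (scale c p) ≐ c · coeff p
coeff-scale c p = pointwise (go p)
  where
  go : ∀ p n → coeff (scale c p) n ≡ c * coeff p n
  go [] n = sym (ℤ.*-zeroʳ c)
  go (a ∷ p) zero = refl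
  go (a ∷ p) (suc n) = go p n

coeff-∷ : ∀ a p → coeff (a ∷ p) ≐ a · coeff 1ₚ ⊞ shift (coeff p)
coeff-∷ a p = pointwise λ
  { zero → sym (trans (ℤ.+-identityʳ _) (ℤ.*-identityʳ a))
  ; (suc n) → sym (trans (cong (_+ coeff p n) (ℤ.*-zeroʳ a)) (ℤ.+-identityˡ _)) }

coeff-0∷ : ∀ p → coeff (+ 0 ∷ p) ≐ shift (coeff p)
coeff-0∷ p = pointwise λ { zero → refl ; (suc n) → refl }

coeff-⊗ : ∀ p q → coeff (p ⊗ q) ≐ p ◃ coeff q
coeff-⊗ [] q = ≐-refl
coeff-⊗ (a ∷ p) q = ≐-trans (coeff-⊕ (scale a q) (+ 0 ∷ (p ⊗ q)))
  (⊞-cong (coeff-scale a q) (≐-trans (coeff-0∷ (p ⊗ q)) (shift-cong (coeff-⊗ p q))))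

◃-congʳ : ∀ p {f g} → f ≐ g → p ◃ f ≐ p ◃ g
◃-congʳ [] e = ≐-refl
◃-congʳ (a ∷ p) e = ⊞-cong (·-congˡ a e) (shift-cong (◃-congʳ p e))

◃-0ₛ : ∀ p → p ◃ 0ₛ ≐ 0ₛ
◃-0ₛ [] = ≐-refl
◃-0ₛ (a ∷ p) = pointwise λ n →
  cong₂ _+_ (ℤ.*-zeroʳ a) (at (≐-trans (shift-cong (◃-0ₛ p)) shift-0ₛ) n)

◃-⊞ : ∀ p f g → p ◃ (f ⊞ g) ≐ p ◃ f ⊞ p ◃ g
◃-⊞ [] f g = pointwise λ _ → refl
◃-⊞ (a ∷ p) f g = pointwise λ n →
  trans (cong (λ u → a * (f n + g n) + u) (at (≐-trans (shift-cong (◃-⊞ p f g)) (shift-⊞ _ _)) n))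
        (regroup a (f n) (g n) _ _)
  where
  regroup : ∀ a x y u v → a * (x + y) + (u + v) ≡ (a * x + u) + (a * y + v)
  regroup = ℤ-Solver.solve-∀

◃-· : ∀ p c f → p ◃ (c · f) ≐ c · (p ◃ f)
◃-· [] c f = pointwise λ _ → sym (ℤ.*-zeroʳ c)
◃-· (a ∷ p) c f = pointwise λ n →
  trans (cong (λ u → a * (c * f n) + u) (at (≐-trans (shift-cong (◃-· p c f)) (shift-· c _)) n))
        (regroup a c (f n) _)
  where
  regroup : ∀ a c x u → a * (c * x) + c * u ≡ c * (a * x + u)
  regroup = ℤ-Solver.solve-∀

◃-shift : ∀ p f → p ◃ shift f ≐ shift (p ◃ f)
◃-shift [] f = ≐-sym shift-0ₛ
◃-shift (a ∷ p) f = ≐-trans (⊞-cong (≐-sym (shift-· a f)) (shift-cong (◃-shift p f)))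
  (≐-sym (shift-⊞ (a · f) (shift (p ◃ f))))

⊕-◃ : ∀ p q f → (p ⊕ q) ◃ f ≐ p ◃ f ⊞ q ◃ f
⊕-◃ [] q f = pointwise λ _ → sym (ℤ.+-identityˡ _)
⊕-◃ (a ∷ p) [] f = pointwise λ _ → sym (ℤ.+-identityʳ _)
⊕-◃ (a ∷ p) (b ∷ q) f = pointwise λ n →
  trans (cong (λ u → (a + b) * f n + u) (at (≐-trans (shift-cong (⊕-◃ p q f)) (shift-⊞ _ _)) n))
        (regroup a b (f n) _ _)
  where
  regroup : ∀ a b x u v → (a + b) * x + (u + v) ≡ (a * x + u) + (b * x + v)
  regroup = ℤ-Solver.solve-∀

scale-◃ : ∀ c p f → scale c p ◃ f ≐ c · (p ◃ f)
scale-◃ c [] f = pointwise λ _ → sym (ℤ.*-zeroʳ c)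
scale-◃ c (a ∷ p) f = pointwise λ n →
  trans (cong (λ u → c * a * f n + u) (at (≐-trans (shift-cong (scale-◃ c p f)) (shift-· c _)) n))
        (regroup c a (f n) _)
  where
  regroup : ∀ c a x u → c * a * x + c * u ≡ c * (a * x + u)
  regroup = ℤ-Solver.solve-∀

0∷-◃ : ∀ p f → (+ 0 ∷ p) ◃ f ≐ shift (p ◃ f)
0∷-◃ p f = pointwise λ _ → ℤ.+-identityˡ _

⊗-◃ : ∀ p q f → (p ⊗ q) ◃ f ≐ p ◃ (q ◃ f)
⊗-◃ [] q f = ≐-refl
⊗-◃ (a ∷ p) q f = ≐-trans (⊕-◃ (scale a q) (+ 0 ∷ (p ⊗ q)) f)
  (⊞-cong (scale-◃ a q f) (≐-trans (0∷-◃ (p ⊗ q) f) (shift-cong (⊗-◃ p q f))))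

1-◃ : ∀ f → 1ₚ ◃ f ≐ f
1-◃ f = pointwise λ n → trans (cong₂ _+_ (ℤ.*-identityˡ (f n)) (at shift-0ₛ n)) (ℤ.+-identityʳ _)

◃-δ : ∀ p → p ◃ coeff 1ₚ ≐ coeff p
◃-δ [] = ≐-refl
◃-δ (a ∷ p) = ≐-sym (≐-trans (coeff-∷ a p) (⊞-congˡ (a · _) (shift-cong (≐-sym (◃-δ p)))))

◃-coeff-comm : ∀ p q → p ◃ coeff q ≐ q ◃ coeff p
◃-coeff-comm [] q = ≐-sym (◃-0ₛ q)
◃-coeff-comm (a ∷ p) q = ≐-sym (begin
  q ◃ coeff (a ∷ p)                                     ≈⟨ ◃-congʳ q (coeff-∷ a p) ⟩
  q ◃ (a · δ ⊞ shift (coeff p))                          ≈⟨ ◃-⊞ q _ _ ⟩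
  q ◃ (a · δ) ⊞ q ◃ shift (coeff p)                      ≈⟨ ⊞-cong (◃-· q a δ) (◃-shift q (coeff p)) ⟩
  a · (q ◃ δ) ⊞ shift (q ◃ coeff p)                      ≈⟨ ⊞-cong (·-congˡ a (◃-δ q)) (shift-cong (◃-coeff-comm q p)) ⟩
  a · coeff q ⊞ shift (p ◃ coeff q)                      ∎)
  where
  open ≐-Reasoning
  δ : Series
  δ = coeff 1ₚ

convCoeff-◃ : ∀ p f n → convCoeff p f n ≡ (p ◃ f) n
convCoeff-◃ p f n = trans (cong sumℤ (map-applyUpTo (λ j → j) (λ j → coeff p j * f (n ∸ j)) (suc n))) (go p f n)
  where
  zeros : ∀ m → sumℤ (applyUpTo (λ _ → + 0) m) ≡ + 0
  zeros zero = refl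
  zeros (suc m) = trans (ℤ.+-identityˡ _) (zeros m)
  go : ∀ p f n → sumℤ (applyUpTo (λ j → coeff p j * f (n ∸ j)) (suc n)) ≡ (p ◃ f) n
  go [] f n = zeros (suc n)
  go (a ∷ p) f zero = refl
  go (a ∷ p) f (suc n) = cong (λ u → a * f (suc n) + u) (go p f n)

-- Polynomials up to trailing zeros

infix 4 _≈ₚ_
record _≈ₚ_ (p q : Poly) : Set where
  constructor coeffwise
  field coeff-≐ : coeff p ≐ coeff q

open _≈ₚ_ public

◃-congˡ : ∀ {p q} → p ≈ₚ q → ∀ f → p ◃ f ≐ q ◃ f
◃-congˡ {p} {q} e f = pointwise λ n → begin
  (p ◃ f) n        ≡⟨ convCoeff-◃ p f n ⟨
  convCoeff p f n  ≡⟨ cong sumℤ (map-cong (λ j → cong (_* f (n ∸ j)) (at (coeff-≐ e) j)) (upTo (suc n))) ⟩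
  convCoeff q f n  ≡⟨ convCoeff-◃ q f n ⟩
  (q ◃ f) n        ∎
  where open ≡-Reasoning

≈ₚ-trans : ∀ {p q r} → p ≈ₚ q → q ≈ₚ r → p ≈ₚ r
≈ₚ-trans e e′ = coeffwise (≐-trans (coeff-≐ e) (coeff-≐ e′))

≈ₚ-isEquivalence : IsEquivalence _≈ₚ_
≈ₚ-isEquivalence = record
  { refl = coeffwise ≐-refl ; sym = λ e → coeffwise (≐-sym (coeff-≐ e)) ; trans = ≈ₚ-trans }

by-coeff : ∀ {p q F} → coeff p ≐ F → coeff q ≐ F → p ≈ₚ q
by-coeff e e′ = coeffwise (≐-trans e (≐-sym e′))

⊕-cong : ∀ {p p′ q q′} → p ≈ₚ p′ → q ≈ₚ q′ → (p ⊕ q) ≈ₚ (p′ ⊕ q′)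
⊕-cong {p} {p′} {q} {q′} e e′ =
  by-coeff (≐-trans (coeff-⊕ p q) (⊞-cong (coeff-≐ e) (coeff-≐ e′))) (coeff-⊕ p′ q′)

⊕-assoc : ∀ p q r → ((p ⊕ q) ⊕ r) ≈ₚ (p ⊕ (q ⊕ r))
⊕-assoc p q r = by-coeff (≐-trans (coeff-⊕ (p ⊕ q) r) (⊞-congʳ (coeff r) (coeff-⊕ p q)))
  (≐-trans (coeff-⊕ p (q ⊕ r)) (≐-trans (⊞-congˡ (coeff p) (coeff-⊕ q r))
    (pointwise λ n → sym (ℤ.+-assoc (coeff p n) _ _))))

⊕-comm : ∀ p q → (p ⊕ q) ≈ₚ (q ⊕ p)
⊕-comm p q = by-coeff (coeff-⊕ p q) (≐-trans (coeff-⊕ q p) (pointwise λ n → ℤ.+-comm (coeff q n) _))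

⊕-identityʳ : ∀ p → (p ⊕ []) ≈ₚ p
⊕-identityʳ p = by-coeff (coeff-⊕ p []) (pointwise λ n → sym (ℤ.+-identityʳ _))

neg-inverseˡ : ∀ p → (neg p ⊕ p) ≈ₚ []
neg-inverseˡ p = coeffwise (≐-trans (coeff-⊕ (neg p) p)
  (≐-trans (⊞-congʳ (coeff p) (coeff-scale (- + 1) p)) (pointwise λ n → cancel (coeff p n))))
  where
  cancel : ∀ c → - + 1 * c + c ≡ + 0
  cancel = ℤ-Solver.solve-∀

neg-inverseʳ : ∀ p → (p ⊕ neg p) ≈ₚ []
neg-inverseʳ p = ≈ₚ-trans (⊕-comm p (neg p)) (neg-inverseˡ p)

neg-cong : ∀ {p q} → p ≈ₚ q → neg p ≈ₚ neg q
neg-cong {p} {q} e = by-coeff (≐-trans (coeff-scale (- + 1) p) (·-congˡ (- + 1) (coeff-≐ e)))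
  (coeff-scale (- + 1) q)

⊗-cong : ∀ {p p′ q q′} → p ≈ₚ p′ → q ≈ₚ q′ → (p ⊗ q) ≈ₚ (p′ ⊗ q′)
⊗-cong {p} {p′} {q} {q′} e e′ = by-coeff
  (≐-trans (coeff-⊗ p q) (≐-trans (◃-congˡ e (coeff q)) (◃-congʳ p′ (coeff-≐ e′))))
  (coeff-⊗ p′ q′)

⊗-assoc : ∀ p q r → ((p ⊗ q) ⊗ r) ≈ₚ (p ⊗ (q ⊗ r))
⊗-assoc p q r = by-coeff (≐-trans (coeff-⊗ (p ⊗ q) r) (⊗-◃ p q (coeff r)))
  (≐-trans (coeff-⊗ p (q ⊗ r)) (◃-congʳ p (coeff-⊗ q r)))

⊗-identityˡ : ∀ p → (1ₚ ⊗ p) ≈ₚ p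
⊗-identityˡ p = coeffwise (≐-trans (coeff-⊗ 1ₚ p) (1-◃ (coeff p)))

⊗-comm : ∀ p q → (p ⊗ q) ≈ₚ (q ⊗ p)
⊗-comm p q = by-coeff (≐-trans (coeff-⊗ p q) (◃-coeff-comm p q)) (coeff-⊗ q p)

⊗-distribˡ : ∀ p q r → (p ⊗ (q ⊕ r)) ≈ₚ ((p ⊗ q) ⊕ (p ⊗ r))
⊗-distribˡ p q r = by-coeff
  (≐-trans (coeff-⊗ p (q ⊕ r)) (≐-trans (◃-congʳ p (coeff-⊕ q r)) (◃-⊞ p _ _)))
  (≐-trans (coeff-⊕ (p ⊗ q) (p ⊗ r)) (⊞-cong (coeff-⊗ p q) (coeff-⊗ p r)))

⊗-distribʳ : ∀ p q r → ((q ⊕ r) ⊗ p) ≈ₚ ((q ⊗ p) ⊕ (r ⊗ p))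
⊗-distribʳ p q r = by-coeff (≐-trans (coeff-⊗ (q ⊕ r) p) (⊕-◃ q r (coeff p)))
  (≐-trans (coeff-⊕ (q ⊗ p) (r ⊗ p)) (⊞-cong (coeff-⊗ q p) (coeff-⊗ r p)))

PolyRing : CommutativeRing 0ℓ 0ℓ
PolyRing = record
  { Carrier = Poly ; _≈_ = _≈ₚ_ ; _+_ = _⊕_ ; _*_ = _⊗_ ; -_ = neg ; 0# = [] ; 1# = 1ₚ
  ; isCommutativeRing = record
    { isRing = record
      { +-isAbelianGroup = record
        { isGroup = record
          { isMonoid = record
            { isSemigroup = record
              { isMagma = record { isEquivalence = ≈ₚ-isEquivalence ; ∙-cong = ⊕-cong }
              ; assoc = ⊕-assoc }
            ; identity = (λ p → coeffwise ≐-refl) , ⊕-identityʳ }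
          ; inverse = neg-inverseˡ , neg-inverseʳ
          ; ⁻¹-cong = neg-cong }
        ; comm = ⊕-comm }
      ; *-cong = ⊗-cong
      ; *-assoc = ⊗-assoc
      ; *-identity = ⊗-identityˡ , λ p → ≈ₚ-trans (⊗-comm p 1ₚ) (⊗-identityˡ p)
      ; distrib = ⊗-distribˡ , ⊗-distribʳ }
    ; *-comm = ⊗-comm } }

module P = CommutativeRing PolyRing

coeffs-vanish-or-witness : ∀ p → p ≈ₚ [] ⊎ Σ ℕ (λ i → coeff p i ≢ + 0)
coeffs-vanish-or-witness [] = inj₁ (coeffwise ≐-refl)
coeffs-vanish-or-witness (a ∷ p) with a ℤ.≟ + 0 | coeffs-vanish-or-witness p
... | no a≢0 | _ = inj₂ (0 , a≢0)
... | yes refl | inj₁ p≈[] = inj₁ (coeffwise (pointwise λ { zero → refl ; (suc i) → at (coeff-≐ p≈[]) i }))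
... | yes refl | inj₂ (i , c≢0) = inj₂ (suc i , c≢0)

PolyACR : ACR.AlmostCommutativeRing 0ℓ 0ℓ
PolyACR = ACR.fromCommutativeRing PolyRing is-zero
  where
  is-zero : ∀ p → Maybe ([] ≈ₚ p)
  is-zero p with coeffs-vanish-or-witness p
  ... | inj₁ p≈[] = just (coeffwise (≐-sym (coeff-≐ p≈[])))
  ... | inj₂ _ = nothing

◃-◃-comm : ∀ p q f → p ◃ (q ◃ f) ≐ q ◃ (p ◃ f)
◃-◃-comm p q f = ≐-trans (≐-sym (⊗-◃ p q f))
  (≐-trans (◃-congˡ (⊗-comm p q) f) (⊗-◃ q p f))

-- Evaluation at x = 1

sumℤ-⊕ : ∀ p q → sumℤ (p ⊕ q) ≡ sumℤ p + sumℤ q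
sumℤ-⊕ [] q = sym (ℤ.+-identityˡ _)
sumℤ-⊕ (a ∷ p) [] = sym (ℤ.+-identityʳ _)
sumℤ-⊕ (a ∷ p) (b ∷ q) = trans (cong (_+_ (a + b)) (sumℤ-⊕ p q)) (regroup a b (sumℤ p) (sumℤ q))
  where
  regroup : ∀ a b c d → a + b + (c + d) ≡ a + c + (b + d)
  regroup = ℤ-Solver.solve-∀

sumℤ-scale : ∀ c p → sumℤ (scale c p) ≡ c * sumℤ p
sumℤ-scale c [] = sym (ℤ.*-zeroʳ c)
sumℤ-scale c (a ∷ p) = trans (cong (_+_ (c * a)) (sumℤ-scale c p)) (sym (ℤ.*-distribˡ-+ c a (sumℤ p)))

sumℤ-⊗ : ∀ p q → sumℤ (p ⊗ q) ≡ sumℤ p * sumℤ q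
sumℤ-⊗ [] q = refl
sumℤ-⊗ (a ∷ p) q = begin
  sumℤ (scale a q ⊕ (+ 0 ∷ (p ⊗ q)))      ≡⟨ sumℤ-⊕ (scale a q) (+ 0 ∷ (p ⊗ q)) ⟩
  sumℤ (scale a q) + (+ 0 + sumℤ (p ⊗ q)) ≡⟨ cong₂ _+_ (sumℤ-scale a q) (trans (ℤ.+-identityˡ _) (sumℤ-⊗ p q)) ⟩
  a * sumℤ q + sumℤ p * sumℤ q            ≡⟨ ℤ.*-distribʳ-+ (sumℤ q) a (sumℤ p) ⟨
  (a + sumℤ p) * sumℤ q                   ∎
  where open ≡-Reasoning

sumℤ-cong : ∀ {p q} → p ≈ₚ q → sumℤ p ≡ sumℤ q
sumℤ-cong {p} {q} p≈q = go p q (at (coeff-≐ p≈q))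
  where
  go : ∀ p q → (∀ i → coeff p i ≡ coeff q i) → sumℤ p ≡ sumℤ q
  go [] [] e = refl
  go [] (b ∷ q) e = trans (sym (ℤ.+-identityˡ (+ 0))) (cong₂ _+_ (e 0) (go [] q (λ i → e (suc i))))
  go (a ∷ p) [] e = trans (cong₂ _+_ (e 0) (go p [] (λ i → e (suc i)))) (ℤ.+-identityˡ (+ 0))
  go (a ∷ p) (b ∷ q) e = cong₂ _+_ (e 0) (go p q (λ i → e (suc i)))

NonzeroAt1 : Poly → Set
NonzeroAt1 p = sumℤ p ≢ + 0

≈ₚ-nonzeroAt1 : ∀ {p q} → p ≈ₚ q → NonzeroAt1 q → NonzeroAt1 p
≈ₚ-nonzeroAt1 p≈q q≠0 p≡0 = q≠0 (trans (sym (sumℤ-cong p≈q)) p≡0)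

⊗-nonzeroAt1 : ∀ p q → NonzeroAt1 p → NonzeroAt1 q → NonzeroAt1 (p ⊗ q)
⊗-nonzeroAt1 p q p≠0 q≠0 pq≡0 with ℤ.i*j≡0⇒i≡0∨j≡0 (sumℤ p) (trans (sym (sumℤ-⊗ p q)) pq≡0)
... | inj₁ p≡0 = p≠0 p≡0
... | inj₂ q≡0 = q≠0 q≡0

-- The square-zero extension Poly ⋉ Series

-- A pair (p , f) stands for p + f with f² = 0. Linear relations between power series with
-- polynomial coefficients are identities in this commutative ring, so the ring solver can combine them.
Ext : Set
Ext = Poly × Series

const : Poly → Ext
const p = p , 0ₛ

series : Series → Ext
series f = [] , f

0ₑ 1ₑ : Ext
0ₑ = const []
1ₑ = const 1ₚ

infix 4 _≈ₑ_
record _≈ₑ_ (u v : Ext) : Set where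
  constructor _,_
  field
    poly-≈ : proj₁ u ≈ₚ proj₁ v
    series-≐ : proj₂ u ≐ proj₂ v

infixl 6 _+ₑ_
infixl 7 _*ₑ_
_+ₑ_ _*ₑ_ : Ext → Ext → Ext
(p , f) +ₑ (q , g) = p ⊕ q , f ⊞ g
(p , f) *ₑ (q , g) = p ⊗ q , p ◃ g ⊞ q ◃ f

infix 8 -ₑ_
-ₑ_ : Ext → Ext
-ₑ (p , f) = neg p , - + 1 · f

≈ₑ-trans : ∀ {u v w} → u ≈ₑ v → v ≈ₑ w → u ≈ₑ w
≈ₑ-trans (e , e′) (d , d′) = P.trans e d , ≐-trans e′ d′

≈ₑ-isEquivalence : IsEquivalence _≈ₑ_
≈ₑ-isEquivalence = record
  { refl = P.refl , ≐-refl
  ; sym = λ (e , e′) → P.sym e , ≐-sym e′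
  ; trans = ≈ₑ-trans }

+ₑ-cong : ∀ {u u′ v v′} → u ≈ₑ u′ → v ≈ₑ v′ → u +ₑ v ≈ₑ u′ +ₑ v′
+ₑ-cong (e , e′) (d , d′) = P.+-cong e d , ⊞-cong e′ d′

+ₑ-assoc : ∀ u v w → (u +ₑ v) +ₑ w ≈ₑ u +ₑ (v +ₑ w)
+ₑ-assoc (p , f) (q , g) (r , h) = P.+-assoc p q r , pointwise λ n → ℤ.+-assoc (f n) (g n) (h n)

+ₑ-comm : ∀ u v → u +ₑ v ≈ₑ v +ₑ u
+ₑ-comm (p , f) (q , g) = P.+-comm p q , pointwise λ n → ℤ.+-comm (f n) (g n)

+ₑ-identityˡ : ∀ u → 0ₑ +ₑ u ≈ₑ u
+ₑ-identityˡ (p , f) = P.refl , pointwise λ n → ℤ.+-identityˡ (f n)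

-ₑ-inverseˡ : ∀ u → (-ₑ u) +ₑ u ≈ₑ 0ₑ
-ₑ-inverseˡ (p , f) = P.-‿inverseˡ p , pointwise λ n → cancel (f n)
  where
  cancel : ∀ c → - + 1 * c + c ≡ + 0
  cancel = ℤ-Solver.solve-∀

-ₑ-cong : ∀ {u v} → u ≈ₑ v → -ₑ u ≈ₑ -ₑ v
-ₑ-cong (e , e′) = P.-‿cong e , ·-congˡ (- + 1) e′

*ₑ-cong : ∀ {u u′ v v′} → u ≈ₑ u′ → v ≈ₑ v′ → u *ₑ v ≈ₑ u′ *ₑ v′
*ₑ-cong {p , _} {p′ , f′} {q , _} {q′ , g′} (e , e′) (d , d′) = P.*-cong e d ,
  ⊞-cong (≐-trans (◃-congʳ p d′) (◃-congˡ e g′)) (≐-trans (◃-congʳ q e′) (◃-congˡ d f′))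

*ₑ-comm : ∀ u v → u *ₑ v ≈ₑ v *ₑ u
*ₑ-comm (p , f) (q , g) = P.*-comm p q , pointwise λ n → ℤ.+-comm ((p ◃ g) n) ((q ◃ f) n)

*ₑ-identityˡ : ∀ u → 1ₑ *ₑ u ≈ₑ u
*ₑ-identityˡ (p , f) = P.*-identityˡ p ,
  ≐-trans (⊞-cong (1-◃ f) (◃-0ₛ p)) (pointwise λ n → ℤ.+-identityʳ (f n))

*ₑ-assoc : ∀ u v w → (u *ₑ v) *ₑ w ≈ₑ u *ₑ (v *ₑ w)
*ₑ-assoc (p , f) (q , g) (r , h) = P.*-assoc p q r , (begin
  (p ⊗ q) ◃ h ⊞ r ◃ (p ◃ g ⊞ q ◃ f)
    ≈⟨ ⊞-cong (⊗-◃ p q h) (◃-⊞ r _ _) ⟩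
  p ◃ (q ◃ h) ⊞ (r ◃ (p ◃ g) ⊞ r ◃ (q ◃ f))
    ≈⟨ ⊞-congˡ (p ◃ (q ◃ h)) (⊞-cong (◃-◃-comm r p g) (≐-trans (◃-◃-comm r q f) (≐-sym (⊗-◃ q r f)))) ⟩
  p ◃ (q ◃ h) ⊞ (p ◃ (r ◃ g) ⊞ (q ⊗ r) ◃ f)
    ≈⟨ pointwise (λ n → sym (ℤ.+-assoc ((p ◃ (q ◃ h)) n) _ _)) ⟩
  (p ◃ (q ◃ h) ⊞ p ◃ (r ◃ g)) ⊞ (q ⊗ r) ◃ f
    ≈⟨ ⊞-congʳ ((q ⊗ r) ◃ f) (≐-sym (◃-⊞ p _ _)) ⟩
  p ◃ (q ◃ h ⊞ r ◃ g) ⊞ (q ⊗ r) ◃ f ∎)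
  where open ≐-Reasoning

*ₑ-distribˡ : ∀ u v w → u *ₑ (v +ₑ w) ≈ₑ u *ₑ v +ₑ u *ₑ w
*ₑ-distribˡ (p , f) (q , g) (r , h) = P.distribˡ p q r ,
  ≐-trans (⊞-cong (◃-⊞ p g h) (⊕-◃ q r f)) (pointwise λ n → regroup ((p ◃ g) n) ((p ◃ h) n) _ _)
  where
  regroup : ∀ a b c d → (a + b) + (c + d) ≡ (a + c) + (b + d)
  regroup = ℤ-Solver.solve-∀

ExtRing : CommutativeRing 0ℓ 0ℓ
ExtRing = record
  { Carrier = Ext ; _≈_ = _≈ₑ_ ; _+_ = _+ₑ_ ; _*_ = _*ₑ_ ; -_ = -ₑ_ ; 0# = 0ₑ ; 1# = 1ₑ
  ; isCommutativeRing = record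
    { isRing = record
      { +-isAbelianGroup = record
        { isGroup = record
          { isMonoid = record
            { isSemigroup = record
              { isMagma = record { isEquivalence = ≈ₑ-isEquivalence ; ∙-cong = +ₑ-cong }
              ; assoc = +ₑ-assoc }
            ; identity = +ₑ-identityˡ , λ u → ≈ₑ-trans (+ₑ-comm u _) (+ₑ-identityˡ u) }
          ; inverse = -ₑ-inverseˡ , λ u → ≈ₑ-trans (+ₑ-comm u _) (-ₑ-inverseˡ u)
          ; ⁻¹-cong = -ₑ-cong }
        ; comm = +ₑ-comm }
      ; *-cong = *ₑ-cong
      ; *-assoc = *ₑ-assoc
      ; *-identity = *ₑ-identityˡ , λ u → ≈ₑ-trans (*ₑ-comm u _) (*ₑ-identityˡ u)
      ; distrib = *ₑ-distribˡ , λ u v w → ≈ₑ-trans (*ₑ-comm (v +ₑ w) u)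
          (≈ₑ-trans (*ₑ-distribˡ u v w) (+ₑ-cong (*ₑ-comm u v) (*ₑ-comm u w))) }
    ; *-comm = *ₑ-comm } }

module Ext = CommutativeRing ExtRing

module ExtSolver where
  open import Algebra.Solver.Ring.AlmostCommutativeRing as A using (_-Raw-AlmostCommutative⟶_)
  ExtACR : A.AlmostCommutativeRing 0ℓ 0ℓ
  ExtACR = A.fromCommutativeRing ExtRing
  ℤ⟶Ext : ℤ.+-*-rawRing -Raw-AlmostCommutative⟶ ExtACR
  ℤ⟶Ext = record
    { ⟦_⟧ = λ c → const (c ∷ [])
    ; +-homo = λ _ _ → Ext.refl
    ; *-homo = λ a b → coeffwise (pointwise λ { zero → sym (ℤ.+-identityʳ _) ; (suc n) → refl }) ,
                       ≐-sym (≐-trans (⊞-cong (◃-0ₛ (a ∷ [])) (◃-0ₛ (b ∷ []))) (pointwise λ _ → refl))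
    ; -‿homo = λ a → coeffwise (pointwise λ { zero → sym (ℤ.-1*i≡-i a) ; (suc n) → refl }) , ≐-refl
    ; 0-homo = coeffwise (pointwise λ { zero → refl ; (suc n) → refl }) , ≐-refl
    ; 1-homo = Ext.refl }
  equal-constants? : ∀ a b → Maybe (const (a ∷ []) ≈ₑ const (b ∷ []))
  equal-constants? a b with a ℤ.≟ b
  ... | yes refl = just (Ext.refl)
  ... | no _ = nothing
  open import Algebra.Solver.Ring ℤ.+-*-rawRing ExtACR ℤ⟶Ext equal-constants? public

module ≈ₑ-Reasoning = SetoidReasoning Ext.setoid

series-cong : ∀ {f g} → f ≐ g → series f ≈ₑ series g
series-cong f≐g = P.refl , f≐g

const-⊗ : ∀ p q → const (p ⊗ q) ≈ₑ const p *ₑ const q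
const-⊗ p q = P.refl ,
  ≐-sym (≐-trans (⊞-cong (◃-0ₛ p) (◃-0ₛ q)) (pointwise λ _ → refl))

const-*ₑ-series : ∀ p f → const p *ₑ series f ≈ₑ series (p ◃ f)
const-*ₑ-series p f = P.zeroʳ p , pointwise λ n → ℤ.+-identityʳ _

nextₑ : Ext → Ext → Ext → Ext
nextₑ X u v = -ₑ ((1ₑ +ₑ X) *ₑ v) +ₑ -ₑ ((X *ₑ X) *ₑ u)

recurrence-step : ∀ {X P g₀ g₁ g₂ g H α₀ α₁ β₀ β₁} →
  X *ₑ g₀ +ₑ (1ₑ +ₑ X) *ₑ g₁ +ₑ X *ₑ g₂ ≈ₑ X *ₑ H →
  P *ₑ g₀ ≈ₑ α₀ *ₑ g +ₑ β₀ *ₑ H →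
  (X *ₑ P) *ₑ g₁ ≈ₑ α₁ *ₑ g +ₑ β₁ *ₑ H →
  (X *ₑ (X *ₑ P)) *ₑ g₂ ≈ₑ nextₑ X α₀ α₁ *ₑ g +ₑ (X *ₑ (X *ₑ P) +ₑ nextₑ X β₀ β₁) *ₑ H
recurrence-step {X} {P} {g₀} {g₁} {g₂} {g} {H} {α₀} {α₁} {β₀} {β₁} rec q₀ q₁ =
  linear-combination₃ (X *ₑ P) (-ₑ (X *ₑ X)) (-ₑ (1ₑ +ₑ X)) rec q₀ q₁
    (solve 11 (λ X P g₀ g₁ g₂ g H α₀ α₁ β₀ β₁ →
       (X :* (X :* P)) :* g₂
         := (:- ((con (+ 1) :+ X) :* α₁) :+ :- ((X :* X) :* α₀)) :* g
            :+ (X :* (X :* P) :+ (:- ((con (+ 1) :+ X) :* β₁) :+ :- ((X :* X) :* β₀))) :* H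
            :+ (X :* P) :* ((X :* g₀ :+ (con (+ 1) :+ X) :* g₁ :+ X :* g₂) :- X :* H)
            :+ (:- (X :* X)) :* (P :* g₀ :- (α₀ :* g :+ β₀ :* H))
            :+ (:- (con (+ 1) :+ X)) :* ((X :* P) :* g₁ :- (α₁ :* g :+ β₁ :* H)))
      Ext.refl X P g₀ g₁ g₂ g H α₀ α₁ β₀ β₁)
  where
  open ExtSolver using (solve; _:=_; _:+_; _:*_; :-_; _:-_; con)
  open LinearCombination ExtRing using (linear-combination₃)

H-equation : ∀ {A X K α β g H S one} →
  α *ₑ (X *ₑ g) ≈ₑ -ₑ (β *ₑ H) →
  A *ₑ S ≈ₑ const (+ 2 ∷ []) *ₑ (X *ₑ g) +ₑ K *ₑ (X *ₑ H) →
  H ≈ₑ one +ₑ S →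
  (A *ₑ (X *ₑ α) +ₑ -ₑ (K *ₑ (X *ₑ (X *ₑ α))) +ₑ const (+ 2 ∷ []) *ₑ (X *ₑ β)) *ₑ H
    ≈ₑ (A *ₑ (X *ₑ α)) *ₑ one
H-equation {A} {X} {K} {α} {β} {g} {H} {S} {one} F₁ F₂ F₃ =
  linear-combination₃ (const (+ 2 ∷ []) *ₑ X) (X *ₑ α) (A *ₑ (X *ₑ α)) F₁ F₂ F₃
    (solve 9 (λ A X K α β g H S one →
       (A :* (X :* α) :+ :- (K :* (X :* (X :* α))) :+ con (+ 2) :* (X :* β)) :* H
         := (A :* (X :* α)) :* one
            :+ (con (+ 2) :* X) :* (α :* (X :* g) :- :- (β :* H))
            :+ (X :* α) :* (A :* S :- (con (+ 2) :* (X :* g) :+ K :* (X :* H)))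
            :+ (A :* (X :* α)) :* (H :- (one :+ S)))
      Ext.refl A X K α β g H S one)
  where
  open ExtSolver using (solve; _:=_; _:+_; _:*_; :-_; _:-_; con)
  open LinearCombination ExtRing using (linear-combination₃)

-- Counting Hertzsprung words by their first letter

∑< : ℕ → (ℕ → ℤ) → ℤ
∑< m f = sum {m} (λ i → f (toℕ i))

∑<-snoc : ∀ m f → ∑< (suc m) f ≡ ∑< m f + f m
∑<-snoc m f = trans (sum-init-last {m} (λ i → f (toℕ i)))
  (cong₂ _+_ (sum-cong-≗ {m} (λ i → cong f (toℕ-inject₁ i))) (cong f (toℕ-fromℕ m)))

∑<-cong : ∀ m {f g} → (∀ i → i ℕ.< m → f i ≡ g i) → ∑< m f ≡ ∑< m g
∑<-cong m e = sum-cong-≗ (λ i → e (toℕ i) (toℕ<n i))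

∑<-+ : ∀ m f g → ∑< m (λ i → f i + g i) ≡ ∑< m f + ∑< m g
∑<-+ m f g = ∑-distrib-+ {m} (λ i → f (toℕ i)) (λ i → g (toℕ i))

∑<-const : ∀ m c → ∑< m (λ _ → c) ≡ + m * c
∑<-const zero c = refl
∑<-const (suc m) c = trans (cong (_+_ c) (∑<-const m c)) (sym (ℤ.suc-* (+ m) c))

∑<-pad : ∀ m G → G 0 ≡ + 0 → G (suc m) ≡ + 0 → ∑< (suc (suc m)) G ≡ ∑< m (λ i → G (suc i))
∑<-pad m G G0≡0 Gm≡0 = begin
  G 0 + ∑< (suc m) (λ i → G (suc i))           ≡⟨ cong₂ _+_ G0≡0 (∑<-snoc m (λ i → G (suc i))) ⟩
  + 0 + (∑< m (λ i → G (suc i)) + G (suc m))   ≡⟨ cong (λ t → + 0 + (∑< m (λ i → G (suc i)) + t)) Gm≡0 ⟩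
  + 0 + (∑< m (λ i → G (suc i)) + + 0)         ≡⟨ trans (ℤ.+-identityˡ _) (ℤ.+-identityʳ _) ⟩
  ∑< m (λ i → G (suc i))                       ∎
  where open ≡-Reasoning

∑<-window : ∀ M a (f : ℕ → ℤ) → suc (suc a) ℕ.< M →
  ∑< M (λ b → if ∣ b - suc a ∣ ≤ᵇ 1 then f b else + 0) ≡ f a + f (suc a) + f (suc (suc a))
∑<-window (suc (suc (suc M))) zero f _ =
  -- beyond b = 2 the test ∣ b - 1 ∣ ≤ᵇ 1 computes to false, leaving a sum of zeros
  trans (cong (λ t → f 0 + (f 1 + (f 2 + t))) (sum-replicate-zero M)) (regroup (f 0) (f 1) (f 2))
  where
  regroup : ∀ a b c → a + (b + (c + + 0)) ≡ a + b + c
  regroup = ℤ-Solver.solve-∀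
∑<-window (suc M) (suc a) f (ℕ.s≤s a+2<M) =
  trans (ℤ.+-identityˡ _) (∑<-window M a (λ b → f (suc b)) a+2<M)
∑<-window (suc (suc zero)) zero f (ℕ.s≤s (ℕ.s≤s ()))

∑-neighbours : ∀ k a f → f 0 ≡ + 0 → f (suc k) ≡ + 0 → a ℕ.< k →
  ∑< k (λ i → if ∣ suc i - suc a ∣ ≤ᵇ 1 then f (suc i) else + 0) ≡ f a + f (suc a) + f (suc (suc a))
∑-neighbours k a f f0≡0 fk≡0 a<k =
  trans (sym (∑<-pad k near (vanish 0 f0≡0) (vanish (suc k) fk≡0)))
        (∑<-window (suc (suc k)) a f (ℕ.s≤s (ℕ.s≤s a<k)))
  where
  near : ℕ → ℤ
  near b = if ∣ b - suc a ∣ ≤ᵇ 1 then f b else + 0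
  vanish : ∀ b → f b ≡ + 0 → near b ≡ + 0
  vanish b fb≡0 with ∣ b - suc a ∣ ≤ᵇ 1
  ... | true = fb≡0
  ... | false = refl

count : {A : Set} → (A → Bool) → List A → ℕ
count p xs = length (filterᵇ p xs)

count-++ : ∀ {A : Set} (p : A → Bool) xs ys → count p (xs ++ ys) ≡ count p xs ℕ.+ count p ys
count-++ p xs ys = trans (cong length (filter-++ (T? ∘ p) xs ys)) (length-++ (filterᵇ p xs))

count-map : ∀ {A B : Set} (p : B → Bool) (f : A → B) xs → count p (map f xs) ≡ count (p ∘ f) xs
count-map p f [] = refl
count-map p f (x ∷ xs) with p (f x)
... | true = cong suc (count-map p f xs)
... | false = count-map p f xs

count-not-∧ : ∀ {A : Set} c (p : A → Bool) xs →
  + count (λ x → not c ∧ p x) xs ≡ (if c then + 0 else + count p xs)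
count-not-∧ false p xs = refl
count-not-∧ true p [] = refl
count-not-∧ true p (x ∷ xs) = count-not-∧ true p xs

count-concatMap : ∀ {A B : Set} (p : B → Bool) (f : A → List B) {m} (g : Fin m → A) →
  + count p (concatMap f (tabulate g)) ≡ sum (λ i → + count p (f (g i)))
count-concatMap p f {zero} g = refl
count-concatMap p f {suc m} g =
  trans (cong +_ (count-++ p (f (g Fin.zero)) (concatMap f (tabulate (g ∘ Fin.suc)))))
        (cong (_+_ (+ count p (f (g Fin.zero)))) (count-concatMap p f (g ∘ Fin.suc)))

module Counting (k : ℕ) where

  startCount : ℕ → Fin k → ℕ
  startCount n a = count (λ w → hertzsprung (a ∷ᵥ w)) (allWords k n)

  h-suc : ∀ n → + h k (suc n) ≡ sum (λ a → + startCount n a)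
  h-suc n = trans (count-concatMap hertzsprung (λ a → map (a ∷ᵥ_) (allWords k n)) (λ a → a))
    (sum-cong-≗ (λ a → cong +_ (count-map hertzsprung (a ∷ᵥ_) (allWords k n))))

  startCount-suc : ∀ n a → + startCount (suc n) a
    ≡ sum (λ b → if ∣ toℕ b - toℕ a ∣ ≤ᵇ 1 then + 0 else + startCount n b)
  startCount-suc n a =
    trans (count-concatMap (λ w → hertzsprung (a ∷ᵥ w)) (λ b → map (b ∷ᵥ_) (allWords k n)) (λ b → b))
      (sum-cong-≗ λ b → trans (cong +_ (count-map (λ w → hertzsprung (a ∷ᵥ w)) (b ∷ᵥ_) (allWords k n)))
        (count-not-∧ (∣ toℕ b - toℕ a ∣ ≤ᵇ 1) (λ w → hertzsprung (b ∷ᵥ w)) (allWords k n)))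

  isLetter : ℕ → Bool
  isLetter a = (1 ≤ᵇ a) ∧ (a ≤ᵇ k)

  -- h[ a ] n is the number of Hertzsprung words of length n with first letter a, where the letters
  -- are 1, …, k; it is 0 for other a.
  h[_] : ℕ → ℕ → ℤ
  h[ a ] zero = + 0
  h[ a ] (suc zero) = if isLetter a then + 1 else + 0
  h[ a ] (suc (suc n)) =
    if isLetter a then ∑< k (λ i → if ∣ suc i - a ∣ ≤ᵇ 1 then + 0 else h[ suc i ] (suc n)) else + 0

  isLetter-suc : ∀ {a} → a ℕ.< k → isLetter (suc a) ≡ true
  isLetter-suc a<k = Equivalence.to T-≡ (ℕ.<⇒<ᵇ a<k)

  h[0] : ∀ n → h[ 0 ] n ≡ + 0
  h[0] zero = refl
  h[0] (suc zero) = refl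
  h[0] (suc (suc n)) = refl

  isLetter-k+1 : isLetter (suc k) ≡ false
  isLetter-k+1 = m≮ᵇm k
    where
    m≮ᵇm : ∀ m → (m ℕ.<ᵇ m) ≡ false
    m≮ᵇm zero = refl
    m≮ᵇm (suc m) = m≮ᵇm m

  h[k+1] : ∀ n → h[ suc k ] n ≡ + 0
  h[k+1] zero = refl
  h[k+1] (suc zero) rewrite isLetter-k+1 = refl
  h[k+1] (suc (suc n)) rewrite isLetter-k+1 = refl

  startCount≡h[] : ∀ n a → + startCount n a ≡ h[ suc (toℕ a) ] (suc n)
  startCount≡h[] zero a rewrite isLetter-suc (toℕ<n a) = refl
  startCount≡h[] (suc n) a rewrite isLetter-suc (toℕ<n a) = trans (startCount-suc n a)
    (sum-cong-≗ λ b → cong (if_then_else_ (∣ toℕ b - toℕ a ∣ ≤ᵇ 1) (+ 0)) (startCount≡h[] n b))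

  h-∑ : ∀ n → + h k (suc n) ≡ ∑< k (λ i → h[ suc i ] (suc n))
  h-∑ n = trans (h-suc n) (sum-cong-≗ (startCount≡h[] n))

  h[]-recurrence : ∀ n a → a ℕ.< k →
    h[ suc a ] (suc n) + (h[ a ] n + h[ suc a ] n + h[ suc (suc a) ] n) ≡ + h k n
  h[]-recurrence zero a a<k rewrite isLetter-suc a<k = refl
  h[]-recurrence (suc n) a a<k rewrite isLetter-suc a<k = begin
    ∑< k far + (F a + F (suc a) + F (suc (suc a)))
      ≡⟨ cong (_+_ (∑< k far)) (∑-neighbours k a F (h[0] (suc n)) (h[k+1] (suc n)) a<k) ⟨
    ∑< k far + ∑< k near        ≡⟨ ∑<-+ k far near ⟨
    ∑< k (λ i → far i + near i) ≡⟨ ∑<-cong k (λ i _ → split (∣ suc i - suc a ∣ ≤ᵇ 1) (F (suc i))) ⟩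
    ∑< k (λ i → F (suc i))      ≡⟨ h-∑ n ⟨
    + h k (suc n)               ∎
    where
    open ≡-Reasoning
    F : ℕ → ℤ
    F b = h[ b ] (suc n)
    far near : ℕ → ℤ
    far i = if ∣ suc i - suc a ∣ ≤ᵇ 1 then + 0 else F (suc i)
    near i = if ∣ suc i - suc a ∣ ≤ᵇ 1 then F (suc i) else + 0
    split : ∀ c v → (if c then + 0 else v) + (if c then v else + 0) ≡ v
    split true v = ℤ.+-identityˡ v
    split false v = ℤ.+-identityʳ v

  h[]-reflect : ∀ n a b → a ℕ.+ b ≡ suc k → h[ a ] n ≡ h[ b ] n
  h[]-reflect zero a b _ = refl
  h[]-reflect (suc n) zero b refl = trans (h[0] (suc n)) (sym (h[k+1] (suc n)))
  h[]-reflect (suc n) (suc a) zero a+0≡k =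
    trans (cong (λ c → h[ c ] (suc n)) (trans (sym (ℕ.+-identityʳ (suc a))) a+0≡k))
          (trans (h[k+1] (suc n)) (sym (h[0] (suc n))))
  h[]-reflect (suc n) (suc a) (suc b) a+b≡k = ∙-cancelʳ (neighbours a) _ _ (begin
    h[ suc a ] (suc n) + neighbours a   ≡⟨ h[]-recurrence n a a<k ⟩
    + h k n                             ≡⟨ h[]-recurrence n b b<k ⟨
    h[ suc b ] (suc n) + neighbours b   ≡⟨ cong (_+_ (h[ suc b ] (suc n))) neighbours-reflect ⟩
    h[ suc b ] (suc n) + neighbours a   ∎)
    where
    open ≡-Reasoning
    open import Algebra.Properties.AbelianGroup ℤ.+-0-abelianGroup using (∙-cancelʳ)
    a+sb≡k : a ℕ.+ suc b ≡ k
    a+sb≡k = ℕ.suc-injective a+b≡k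
    1+a+b≡k : suc (a ℕ.+ b) ≡ k
    1+a+b≡k = trans (sym (ℕ.+-suc a b)) a+sb≡k
    a<k : a ℕ.< k
    a<k = ℕ.≤-trans (ℕ.s≤s (ℕ.m≤m+n a b)) (ℕ.≤-reflexive 1+a+b≡k)
    b<k : b ℕ.< k
    b<k = ℕ.≤-trans (ℕ.s≤s (ℕ.m≤n+m b a)) (ℕ.≤-reflexive 1+a+b≡k)
    neighbours : ℕ → ℤ
    neighbours c = h[ c ] n + h[ suc c ] n + h[ suc (suc c) ] n
    neighbours-reflect : neighbours b ≡ neighbours a
    neighbours-reflect = trans (reverse (h[ b ] n) _ _)
      (cong₂ _+_ (cong₂ _+_ (h[]-reflect n (suc (suc b)) a (trans (cong suc (ℕ.+-comm (suc b) a)) a+b≡k))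
                             (h[]-reflect n (suc b) (suc a) (trans (ℕ.+-comm (suc b) (suc a)) a+b≡k)))
                 (h[]-reflect n b (suc (suc a)) (trans (ℕ.+-comm b (suc (suc a))) (cong suc 1+a+b≡k))))
      where
      reverse : ∀ x y z → x + y + z ≡ z + y + x
      reverse = ℤ-Solver.solve-∀

  letterSum : ℕ → ℤ
  letterSum n = ∑< k (λ i → h[ suc i ] n)

  letterSum-0 : letterSum 0 ≡ + 0
  letterSum-0 = sum-replicate-zero k

  letterSum-recurrence : ∀ n → letterSum (suc n) + + 3 * letterSum n ≡ + k * + h k n + + 2 * h[ 1 ] n
  letterSum-recurrence n = begin
    S′ + + 3 * S                              ≡⟨ regroup S′ S L R ⟩
    (S′ + (L + S + R)) + ((S + - L) + (S + - R)) ≡⟨ cong₂ _+_ all-letters (cong₂ _+_ (solve-for L left) (solve-for R right)) ⟩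
    + k * H + (h₁ + h₁)                        ≡⟨ cong (_+_ (+ k * H)) (double h₁) ⟩
    + k * H + + 2 * h₁                         ∎
    where
    open ≡-Reasoning
    S′ S L R H h₁ : ℤ
    S′ = letterSum (suc n)
    S = letterSum n
    L = ∑< k (λ i → h[ i ] n)
    R = ∑< k (λ i → h[ suc (suc i) ] n)
    H = + h k n
    h₁ = h[ 1 ] n
    regroup : ∀ S′ S L R → S′ + + 3 * S ≡ (S′ + (L + S + R)) + ((S + - L) + (S + - R))
    regroup = ℤ-Solver.solve-∀
    double : ∀ x → x + x ≡ + 2 * x
    double = ℤ-Solver.solve-∀
    solve-for : ∀ x {y z} → x + y ≡ z → z + - x ≡ y
    solve-for x {y} refl = cancel x y
      where
      cancel : ∀ x y → x + y + - x ≡ y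
      cancel = ℤ-Solver.solve-∀
    all-letters : S′ + (L + S + R) ≡ + k * H
    all-letters = begin
      S′ + (L + S + R)
        ≡⟨ cong (_+_ S′) (trans (∑<-+ k (λ i → h[ i ] n + h[ suc i ] n) (λ i → h[ suc (suc i) ] n))
                                 (cong (_+ R) (∑<-+ k (λ i → h[ i ] n) (λ i → h[ suc i ] n)))) ⟨
      S′ + ∑< k (λ i → h[ i ] n + h[ suc i ] n + h[ suc (suc i) ] n)
        ≡⟨ ∑<-+ k (λ i → h[ suc i ] (suc n)) (λ i → h[ i ] n + h[ suc i ] n + h[ suc (suc i) ] n) ⟨
      ∑< k (λ i → h[ suc i ] (suc n) + (h[ i ] n + h[ suc i ] n + h[ suc (suc i) ] n))
        ≡⟨ ∑<-cong k (λ i i<k → h[]-recurrence n i i<k) ⟩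
      ∑< k (λ _ → H)      ≡⟨ ∑<-const k H ⟩
      + k * H             ∎
    left : L + h₁ ≡ S
    left = begin
      L + h₁                   ≡⟨ cong (_+_ L) (h[]-reflect n 1 k refl) ⟩
      L + h[ k ] n             ≡⟨ ∑<-snoc k (λ i → h[ i ] n) ⟨
      h[ 0 ] n + S             ≡⟨ cong (_+ S) (h[0] n) ⟩
      + 0 + S                  ≡⟨ ℤ.+-identityˡ S ⟩
      S                        ∎
    right : R + h₁ ≡ S
    right = begin
      R + h₁                   ≡⟨ ℤ.+-comm R h₁ ⟩
      h₁ + R                   ≡⟨ ∑<-snoc k (λ i → h[ suc i ] n) ⟩
      S + h[ suc k ] n         ≡⟨ cong (_+_ S) (h[k+1] n) ⟩
      S + + 0                  ≡⟨ ℤ.+-identityʳ S ⟩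
      S                        ∎

-- Generating functions

xpow : ℕ → Poly
xpow zero = 1ₚ
xpow (suc n) = xₚ ⊗ xpow n

nextₚ : Poly → Poly → Poly
nextₚ u v = neg ((1ₚ ⊕ xₚ) ⊗ v) ⊕ neg ((xₚ ⊗ xₚ) ⊗ u)

-- scaledU (suc n) = xⁿ Uₙ(−(1+x)/(2x)): nextₚ is Uₙ₊₁ = 2y Uₙ − Uₙ₋₁ multiplied by xⁿ⁺¹.
scaledU : ℕ → Poly
scaledU zero = []
scaledU (suc zero) = 1ₚ
scaledU (suc (suc n)) = nextₚ (scaledU n) (scaledU (suc n))

particular : ℕ → Poly
particular zero = []
particular (suc zero) = []
particular (suc (suc n)) = xpow (suc (suc n)) ⊕ nextₚ (particular n) (particular (suc n))

X̂ : Ext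
X̂ = const xₚ

const-next : ∀ u v → const (nextₚ u v) ≈ₑ nextₑ X̂ (const u) (const v)
const-next u v = begin
  -ₑ const ((1ₚ ⊕ xₚ) ⊗ v) +ₑ -ₑ const ((xₚ ⊗ xₚ) ⊗ u)
    ≈⟨ Ext.+-cong (Ext.-‿cong (const-⊗ (1ₚ ⊕ xₚ) v)) (Ext.-‿cong (const-⊗ (xₚ ⊗ xₚ) u)) ⟩
  -ₑ ((1ₑ +ₑ X̂) *ₑ const v) +ₑ -ₑ (const (xₚ ⊗ xₚ) *ₑ const u)
    ≈⟨ Ext.+-congˡ { -ₑ ((1ₑ +ₑ X̂) *ₑ const v)} (Ext.-‿cong (Ext.*-congʳ {const u} (const-⊗ xₚ xₚ))) ⟩
  nextₑ X̂ (const u) (const v) ∎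
  where open ≈ₑ-Reasoning

c-◃ : ∀ c f → (c ∷ []) ◃ f ≐ c · f
c-◃ c f = pointwise λ n → trans (cong (_+_ (c * f n)) (at shift-0ₛ n)) (ℤ.+-identityʳ _)

xₚ-◃ : ∀ f → xₚ ◃ f ≐ shift f
xₚ-◃ f = ≐-trans (0∷-◃ 1ₚ f) (shift-cong (1-◃ f))

linear-◃ : ∀ a b f → (a ∷ b ∷ []) ◃ f ≐ a · f ⊞ b · shift f
linear-◃ a b f = ⊞-congˡ (a · f) (≐-trans (shift-cong (c-◃ b f)) (shift-· b f))

c-X̂-series : ∀ c f → const (c ∷ []) *ₑ (X̂ *ₑ series f) ≈ₑ series (c · shift f)
c-X̂-series c f = Ext.trans (Ext.*-congˡ {const (c ∷ [])} (const-*ₑ-series xₚ f))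
  (Ext.trans (const-*ₑ-series (c ∷ []) (xₚ ◃ f)) (series-cong (≐-trans (c-◃ c (xₚ ◃ f)) (·-congˡ c (xₚ-◃ f)))))

1+3x : Poly
1+3x = + 1 ∷ + 3 ∷ []

d₀ n₀ : ℕ → Poly
d₀ k = 1+3x ⊗ (xₚ ⊗ scaledU (suc k))
n₀ k = (d₀ k ⊕ neg ((+ k ∷ []) ⊗ (xₚ ⊗ (xₚ ⊗ scaledU (suc k))))) ⊕ ((+ 2 ∷ []) ⊗ (xₚ ⊗ particular (suc k)))

module GeneratingFunction (k : ℕ) where
  open Counting k

  Hₛ : Series
  Hₛ n = + h k n

  Ĥ Σ̂ δ̂ : Ext
  Ĥ = series Hₛ
  Σ̂ = series letterSum
  δ̂ = series (coeff 1ₚ)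

  ĝ : ℕ → Ext
  ĝ a = series h[ a ]

  letter-relation : ∀ a → a ℕ.< k →
    X̂ *ₑ ĝ a +ₑ (1ₑ +ₑ X̂) *ₑ ĝ (suc a) +ₑ X̂ *ₑ ĝ (suc (suc a)) ≈ₑ X̂ *ₑ Ĥ
  letter-relation a a<k = begin
    X̂ *ₑ ĝ a +ₑ (1ₑ +ₑ X̂) *ₑ ĝ (suc a) +ₑ X̂ *ₑ ĝ (suc (suc a))
      ≈⟨ Ext.+-cong (Ext.+-cong (const-*ₑ-series xₚ h[ a ]) (const-*ₑ-series (1ₚ ⊕ xₚ) h[ suc a ]))
                    (const-*ₑ-series xₚ h[ suc (suc a) ]) ⟩
    series (xₚ ◃ h[ a ] ⊞ (1ₚ ⊕ xₚ) ◃ h[ suc a ] ⊞ xₚ ◃ h[ suc (suc a) ])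
      ≈⟨ series-cong (⊞-cong (⊞-cong (xₚ-◃ h[ a ]) (linear-◃ (+ 1) (+ 1) h[ suc a ])) (xₚ-◃ h[ suc (suc a) ])) ⟩
    series (shift h[ a ] ⊞ (+ 1 · h[ suc a ] ⊞ + 1 · shift h[ suc a ]) ⊞ shift h[ suc (suc a) ])
      ≈⟨ series-cong (pointwise coefficients) ⟩
    series (shift Hₛ)
      ≈⟨ series-cong (xₚ-◃ Hₛ) ⟨
    series (xₚ ◃ Hₛ)
      ≈⟨ const-*ₑ-series xₚ Hₛ ⟨
    X̂ *ₑ Ĥ ∎
    where
    open ≈ₑ-Reasoning
    regroup : ∀ x y y′ z → x + (+ 1 * y′ + + 1 * y) + z ≡ y′ + (x + y + z)
    regroup = ℤ-Solver.solve-∀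
    coefficients : ∀ n → (shift h[ a ] ⊞ (+ 1 · h[ suc a ] ⊞ + 1 · shift h[ suc a ]) ⊞ shift h[ suc (suc a) ]) n
                         ≡ shift Hₛ n
    coefficients zero = refl
    coefficients (suc n) = trans (regroup (h[ a ] n) (h[ suc a ] n) (h[ suc a ] (suc n)) (h[ suc (suc a) ] n))
                                 (h[]-recurrence n a a<k)

  sum-relation : const 1+3x *ₑ Σ̂ ≈ₑ const (+ 2 ∷ []) *ₑ (X̂ *ₑ ĝ 1) +ₑ const (+ k ∷ []) *ₑ (X̂ *ₑ Ĥ)
  sum-relation = begin
    const 1+3x *ₑ Σ̂                                   ≈⟨ const-*ₑ-series 1+3x letterSum ⟩
    series (1+3x ◃ letterSum)                          ≈⟨ series-cong (linear-◃ (+ 1) (+ 3) letterSum) ⟩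
    series (+ 1 · letterSum ⊞ + 3 · shift letterSum)  ≈⟨ series-cong (pointwise coefficients) ⟩
    series (+ 2 · shift h[ 1 ] ⊞ + k · shift Hₛ)       ≈⟨ Ext.+-cong (c-X̂-series (+ 2) h[ 1 ]) (c-X̂-series (+ k) Hₛ) ⟨
    const (+ 2 ∷ []) *ₑ (X̂ *ₑ ĝ 1) +ₑ const (+ k ∷ []) *ₑ (X̂ *ₑ Ĥ) ∎
    where
    open ≈ₑ-Reasoning
    regroup : ∀ S′ S g H K → S′ + + 3 * S ≡ K * H + + 2 * g → + 1 * S′ + + 3 * S ≡ + 2 * g + K * H
    regroup S′ S g H K e = trans (cong₂ _+_ (ℤ.*-identityˡ S′) refl) (trans e (ℤ.+-comm (K * H) _))
    coefficients : ∀ n → (+ 1 · letterSum ⊞ + 3 · shift letterSum) n ≡ (+ 2 · shift h[ 1 ] ⊞ + k · shift Hₛ) n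
    coefficients zero =
      trans (cong (λ s → + 1 * s + + 0) letterSum-0) (sym (trans (ℤ.+-identityˡ _) (ℤ.*-zeroʳ (+ k))))
    coefficients (suc n) =
      regroup (letterSum (suc n)) (letterSum n) (h[ 1 ] n) (Hₛ n) (+ k) (letterSum-recurrence n)

  total-relation : Ĥ ≈ₑ δ̂ +ₑ Σ̂
  total-relation = series-cong (pointwise coefficients)
    where
    coefficients : ∀ n → Hₛ n ≡ coeff 1ₚ n + letterSum n
    coefficients zero = sym (cong (_+_ (+ 1)) letterSum-0)
    coefficients (suc n) = trans (h-∑ n) (sym (ℤ.+-identityˡ _))

  Solved : ℕ → Set
  Solved j = const (xpow j) *ₑ ĝ j ≈ₑ const (scaledU j) *ₑ (X̂ *ₑ ĝ 1) +ₑ const (particular j) *ₑ Ĥ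

  solved-0 : Solved 0
  solved-0 = begin
    1ₑ *ₑ ĝ 0                                  ≈⟨ Ext.*-identityˡ (ĝ 0) ⟩
    ĝ 0                                        ≈⟨ series-cong (pointwise h[0]) ⟩
    0ₑ                                         ≈⟨ Ext.+-identityˡ 0ₑ ⟨
    0ₑ +ₑ 0ₑ                                   ≈⟨ Ext.+-cong (Ext.zeroˡ (X̂ *ₑ ĝ 1)) (Ext.zeroˡ Ĥ) ⟨
    0ₑ *ₑ (X̂ *ₑ ĝ 1) +ₑ 0ₑ *ₑ Ĥ                ∎
    where open ≈ₑ-Reasoning

  solved-1 : Solved 1
  solved-1 = begin
    const (xₚ ⊗ 1ₚ) *ₑ ĝ 1                     ≈⟨ Ext.*-congʳ {ĝ 1} (Ext.trans (const-⊗ xₚ 1ₚ) (Ext.*-identityʳ X̂)) ⟩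
    X̂ *ₑ ĝ 1                                   ≈⟨ Ext.*-identityˡ (X̂ *ₑ ĝ 1) ⟨
    1ₑ *ₑ (X̂ *ₑ ĝ 1)                           ≈⟨ Ext.+-identityʳ (1ₑ *ₑ (X̂ *ₑ ĝ 1)) ⟨
    1ₑ *ₑ (X̂ *ₑ ĝ 1) +ₑ 0ₑ                     ≈⟨ Ext.+-congˡ {1ₑ *ₑ (X̂ *ₑ ĝ 1)} (Ext.zeroˡ Ĥ) ⟨
    1ₑ *ₑ (X̂ *ₑ ĝ 1) +ₑ 0ₑ *ₑ Ĥ                ∎
    where open ≈ₑ-Reasoning

  solved-step : ∀ j → j ℕ.< k → Solved j → Solved (suc j) → Solved (suc (suc j))
  solved-step j j<k solved-j solved-1+j = begin
    const (xpow (suc (suc j))) *ₑ ĝ (suc (suc j))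
      ≈⟨ Ext.*-congʳ {ĝ (suc (suc j))} X²P ⟩
    (X̂ *ₑ (X̂ *ₑ P)) *ₑ ĝ (suc (suc j))
      ≈⟨ recurrence-step {X̂} {P} {ĝ j} {ĝ (suc j)} {ĝ (suc (suc j))} {X̂ *ₑ ĝ 1} {Ĥ}
                    {const (scaledU j)} {const (scaledU (suc j))} {const (particular j)} {const (particular (suc j))}
           (letter-relation j j<k) solved-j
           (Ext.trans (Ext.*-congʳ {ĝ (suc j)} (Ext.sym (const-⊗ xₚ (xpow j)))) solved-1+j) ⟩
    nextₑ X̂ (const (scaledU j)) (const (scaledU (suc j))) *ₑ (X̂ *ₑ ĝ 1)
      +ₑ (X̂ *ₑ (X̂ *ₑ P) +ₑ nextₑ X̂ (const (particular j)) (const (particular (suc j)))) *ₑ Ĥ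
      ≈⟨ Ext.+-cong (Ext.*-congʳ {X̂ *ₑ ĝ 1} (const-next (scaledU j) (scaledU (suc j))))
                    (Ext.*-congʳ {Ĥ} (Ext.+-cong X²P (const-next (particular j) (particular (suc j))))) ⟨
    const (scaledU (suc (suc j))) *ₑ (X̂ *ₑ ĝ 1) +ₑ const (particular (suc (suc j))) *ₑ Ĥ ∎
    where
    open ≈ₑ-Reasoning
    P : Ext
    P = const (xpow j)
    X²P : const (xpow (suc (suc j))) ≈ₑ X̂ *ₑ (X̂ *ₑ P)
    X²P = Ext.trans (const-⊗ xₚ (xₚ ⊗ xpow j)) (Ext.*-congˡ {X̂} (const-⊗ xₚ (xpow j)))

  solved-upto : ∀ j → j ℕ.≤ k → Solved j × Solved (suc j)
  solved-upto zero _ = solved-0 , solved-1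
  solved-upto (suc j) j<k with solved-upto j (ℕ.<⇒≤ j<k)
  ... | solved-j , solved-1+j = solved-1+j , solved-step j j<k solved-j solved-1+j

  n₀-◃-H : n₀ k ◃ Hₛ ≐ coeff (d₀ k)
  n₀-◃-H = ≐-trans (_≈ₑ_.series-≐ (begin
    series (n₀ k ◃ Hₛ)   ≈⟨ const-*ₑ-series (n₀ k) Hₛ ⟨
    const (n₀ k) *ₑ Ĥ    ≈⟨ Ext.*-congʳ {Ĥ} lift-n₀ ⟩
    (A *ₑ (X̂ *ₑ α) +ₑ -ₑ (K *ₑ (X̂ *ₑ (X̂ *ₑ α))) +ₑ const (+ 2 ∷ []) *ₑ (X̂ *ₑ β)) *ₑ Ĥ
                         ≈⟨ H-equation {A} {X̂} {K} {α} {β} {ĝ 1} {Ĥ} {Σ̂} {δ̂} vanishing sum-relation total-relation ⟩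
    (A *ₑ (X̂ *ₑ α)) *ₑ δ̂ ≈⟨ Ext.*-congʳ {δ̂} lift-d₀ ⟨
    const (d₀ k) *ₑ δ̂    ≈⟨ const-*ₑ-series (d₀ k) (coeff 1ₚ) ⟩
    series (d₀ k ◃ coeff 1ₚ) ∎)) (◃-δ (d₀ k))
    where
    open ≈ₑ-Reasoning
    open import Algebra.Properties.Group Ext.+-group using (inverseˡ-unique)
    A K α β : Ext
    A = const 1+3x
    K = const (+ k ∷ [])
    α = const (scaledU (suc k))
    β = const (particular (suc k))
    const-⊗₂ : ∀ p q r → const (p ⊗ (q ⊗ r)) ≈ₑ const p *ₑ (const q *ₑ const r)
    const-⊗₂ p q r = Ext.trans (const-⊗ p (q ⊗ r)) (Ext.*-congˡ {const p} (const-⊗ q r))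
    lift-d₀ : const (d₀ k) ≈ₑ A *ₑ (X̂ *ₑ α)
    lift-d₀ = const-⊗₂ 1+3x xₚ (scaledU (suc k))
    lift-n₀ : const (n₀ k) ≈ₑ A *ₑ (X̂ *ₑ α) +ₑ -ₑ (K *ₑ (X̂ *ₑ (X̂ *ₑ α))) +ₑ const (+ 2 ∷ []) *ₑ (X̂ *ₑ β)
    lift-n₀ = Ext.+-cong (Ext.+-cong lift-d₀ (Ext.-‿cong (Ext.trans (const-⊗ (+ k ∷ []) (xₚ ⊗ (xₚ ⊗ scaledU (suc k))))
                                                            (Ext.*-congˡ {K} (const-⊗₂ xₚ xₚ (scaledU (suc k)))))))
                         (const-⊗₂ (+ 2 ∷ []) xₚ (particular (suc k)))
    vanishing : α *ₑ (X̂ *ₑ ĝ 1) ≈ₑ -ₑ (β *ₑ Ĥ)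
    vanishing = inverseˡ-unique _ _ (Ext.trans (Ext.sym (proj₂ (solved-upto k ℕ.≤-refl)))
      (Ext.trans (Ext.*-congˡ {const (xpow (suc k))} (series-cong (pointwise h[k+1])))
                 (Ext.zeroʳ (const (xpow (suc k))))))

-- Defs never cancels common factors of fractions, so fractions are compared up to a common factor
-- that does not vanish at x = 1.
infix 4 _≃_
record _≃_ (F G : Frac) : Set where
  field
    factor : Poly
    factor-nonzero : NonzeroAt1 factor
    numerator : proj₁ F ≈ₚ proj₁ G ⊗ factor
    denominator : proj₂ F ≈ₚ proj₂ G ⊗ factor

≃-trans : ∀ {F G H} → F ≃ G → G ≃ H → F ≃ H
≃-trans {F} {G} {H} F≃G G≃H = record
  { factor = S ⊗ R
  ; factor-nonzero = ⊗-nonzeroAt1 S R (_≃_.factor-nonzero G≃H) (_≃_.factor-nonzero F≃G)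
  ; numerator = P.trans (_≃_.numerator F≃G) (P.trans (P.*-congʳ (_≃_.numerator G≃H)) (P.*-assoc (proj₁ H) S R))
  ; denominator = P.trans (_≃_.denominator F≃G) (P.trans (P.*-congʳ (_≃_.denominator G≃H)) (P.*-assoc (proj₂ H) S R)) }
  where
  R S : Poly
  R = _≃_.factor F≃G
  S = _≃_.factor G≃H

≃-refl : ∀ {F} → F ≃ F
≃-refl = record
  { factor = 1ₚ ; factor-nonzero = λ () ; numerator = P.sym (P.*-identityʳ _) ; denominator = P.sym (P.*-identityʳ _) }

+f-resp : ∀ {F₁ G₁ F₂ G₂} → F₁ ≃ G₁ → F₂ ≃ G₂ → F₁ +f F₂ ≃ G₁ +f G₂
+f-resp {_} {n₁ , d₁} {_} {n₂ , d₂} e₁ e₂ = record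
  { factor = R₁ ⊗ R₂
  ; factor-nonzero = ⊗-nonzeroAt1 R₁ R₂ (factor-nonzero e₁) (factor-nonzero e₂)
  ; numerator = P.trans (P.+-cong (P.*-cong (numerator e₁) (denominator e₂)) (P.*-cong (numerator e₂) (denominator e₁)))
      (sum-identity n₁ d₁ R₁ n₂ d₂ R₂)
  ; denominator = P.trans (P.*-cong (denominator e₁) (denominator e₂)) (product-identity d₁ R₁ d₂ R₂) }
  where
  open _≃_
  R₁ R₂ : Poly
  R₁ = factor e₁
  R₂ = factor e₂
  sum-identity : ∀ n₁ d₁ R₁ n₂ d₂ R₂ →
    ((n₁ ⊗ R₁) ⊗ (d₂ ⊗ R₂)) ⊕ ((n₂ ⊗ R₂) ⊗ (d₁ ⊗ R₁)) ≈ₚ ((n₁ ⊗ d₂) ⊕ (n₂ ⊗ d₁)) ⊗ (R₁ ⊗ R₂)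
  sum-identity = solve-∀ PolyACR
  product-identity : ∀ d₁ R₁ d₂ R₂ → (d₁ ⊗ R₁) ⊗ (d₂ ⊗ R₂) ≈ₚ (d₁ ⊗ d₂) ⊗ (R₁ ⊗ R₂)
  product-identity = solve-∀ PolyACR

*f-resp : ∀ {F₁ G₁ F₂ G₂} → F₁ ≃ G₁ → F₂ ≃ G₂ → F₁ *f F₂ ≃ G₁ *f G₂
*f-resp {_} {n₁ , d₁} {_} {n₂ , d₂} e₁ e₂ = record
  { factor = R₁ ⊗ R₂
  ; factor-nonzero = ⊗-nonzeroAt1 R₁ R₂ (factor-nonzero e₁) (factor-nonzero e₂)
  ; numerator = P.trans (P.*-cong (numerator e₁) (numerator e₂)) (product-identity n₁ R₁ n₂ R₂)
  ; denominator = P.trans (P.*-cong (denominator e₁) (denominator e₂)) (product-identity d₁ R₁ d₂ R₂) }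
  where
  open _≃_
  R₁ R₂ : Poly
  R₁ = factor e₁
  R₂ = factor e₂
  product-identity : ∀ a R₁ b R₂ → (a ⊗ R₁) ⊗ (b ⊗ R₂) ≈ₚ (a ⊗ b) ⊗ (R₁ ⊗ R₂)
  product-identity = solve-∀ PolyACR

negf-resp : ∀ {F G} → F ≃ G → negf F ≃ negf G
negf-resp {_} {n , d} e = record
  { factor = factor e
  ; factor-nonzero = factor-nonzero e
  ; numerator = P.trans (P.-‿cong (numerator e)) (neg-identity n (factor e))
  ; denominator = denominator e }
  where
  open _≃_
  neg-identity : ∀ n R → neg (n ⊗ R) ≈ₚ neg n ⊗ R
  neg-identity = solve-∀ PolyACR

invf-resp : ∀ {F G} → F ≃ G → invf F ≃ invf G
invf-resp e = record
  { factor = factor e ; factor-nonzero = factor-nonzero e ; numerator = denominator e ; denominator = numerator e }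
  where open _≃_

-f-resp : ∀ {F₁ G₁ F₂ G₂} → F₁ ≃ G₁ → F₂ ≃ G₂ → F₁ -f F₂ ≃ G₁ -f G₂
-f-resp e₁ e₂ = +f-resp e₁ (negf-resp e₂)

/f-resp : ∀ {F₁ G₁ F₂ G₂} → F₁ ≃ G₁ → F₂ ≃ G₂ → F₁ /f F₂ ≃ G₁ /f G₂
/f-resp e₁ e₂ = *f-resp e₁ (invf-resp e₂)

xpow-at-1 : ∀ n → sumℤ (xpow n) ≡ + 1
xpow-at-1 zero = refl
xpow-at-1 (suc n) = trans (sumℤ-⊗ xₚ (xpow n)) (cong (_*_ (+ 1)) (xpow-at-1 n))

xpow-nonzero : ∀ n → NonzeroAt1 (xpow n)
xpow-nonzero n x≡0 with trans (sym (xpow-at-1 n)) x≡0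
... | ()

-- Defs' fraction operations and the polynomials above, transcribed into solver syntax: evaluating
-- these expressions gives the original definitions back definitionally.
module PolySyntax where
  open import Tactic.RingSolver.NonReflective PolyACR public using (solve; _⊜_)
  open import Tactic.RingSolver.Core.Expression public using (Expr; Κ)
    renaming (_⊕_ to _⊕ᵉ_; _⊗_ to _⊗ᵉ_; ⊝_ to ⊝ᵉ_)

  module _ {m : ℕ} where
    infixl 6 _+ᵉ_ _-ᵉ_
    infixl 7 _*ᵉ_ _/ᵉ_

    E : Set
    E = Expr Poly m

    cstᵉ : ℤ → E × E
    cstᵉ c = Κ (c ∷ []) , Κ 1ₚ

    Xᵉ : E → E × E
    Xᵉ x = x , Κ 1ₚ

    negᵉ invᵉ : E × E → E × E
    negᵉ (a , b) = ⊝ᵉ a , b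
    invᵉ (a , b) = b , a

    _+ᵉ_ _*ᵉ_ _-ᵉ_ _/ᵉ_ : E × E → E × E → E × E
    (a , b) +ᵉ (c , d) = (a ⊗ᵉ d) ⊕ᵉ (c ⊗ᵉ b) , b ⊗ᵉ d
    (a , b) *ᵉ (c , d) = a ⊗ᵉ c , b ⊗ᵉ d
    p -ᵉ q = p +ᵉ negᵉ q
    p /ᵉ q = p *ᵉ invᵉ q

    yᵉ : E → E × E
    yᵉ x = negᵉ (cstᵉ (+ 1) +ᵉ Xᵉ x) /ᵉ (cstᵉ (+ 2) *ᵉ Xᵉ x)

    nextᵉ : E → E → E → E
    nextᵉ x u v = ⊝ᵉ ((Κ 1ₚ ⊕ᵉ x) ⊗ᵉ v) ⊕ᵉ ⊝ᵉ ((x ⊗ᵉ x) ⊗ᵉ u)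

    Aᵉ : E → E
    Aᵉ x = Κ 1ₚ ⊕ᵉ Κ (+ 3 ∷ []) ⊗ᵉ x

    rhsᵉ : E → E → E × E → E × E → E × E
    rhsᵉ x K u u′ = invᵉ ((cstᵉ (+ 1) -ᵉ ((K , Κ 1ₚ) *ᵉ Xᵉ x) /ᵉ Aᶠ)
                          -ᵉ ((cstᵉ (+ 2) *ᵉ (Xᵉ x *ᵉ Xᵉ x)) /ᵉ (Aᶠ *ᵉ Aᶠ)) *ᵉ (((u -ᵉ u′) -ᵉ cstᵉ (+ 1)) /ᵉ u))
      where
      Aᶠ : E × E
      Aᶠ = cstᵉ (+ 1) +ᵉ (cstᵉ (+ 3) *ᵉ Xᵉ x)

    closedᵉ : E → E → E → E → E
    closedᵉ x w q₀ q₁ = ((x ⊗ᵉ (x ⊗ᵉ w)) ⊕ᵉ ⊝ᵉ ((x ⊗ᵉ x) ⊗ᵉ q₁)) ⊕ᵉ ((x ⊗ᵉ (x ⊗ᵉ x)) ⊗ᵉ q₀)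

open PolySyntax

U-step-reduced : ∀ q₁ q₂ z → NonzeroAt1 z →
  ((cst (+ 2) *f yArg) *f (q₂ , xₚ ⊗ z)) -f (q₁ , z) ≃ (nextₚ q₁ q₂ , xₚ ⊗ (xₚ ⊗ z))
U-step-reduced q₁ q₂ z z≠0 = record
  { factor = (+ 2 ∷ []) ⊗ z
  ; factor-nonzero = ⊗-nonzeroAt1 (+ 2 ∷ []) z (λ ()) z≠0
  ; numerator = solve 4 (λ x q₁ q₂ z → proj₁ ((cstᵉ (+ 2) *ᵉ yᵉ x) *ᵉ (q₂ , x ⊗ᵉ z) -ᵉ (q₁ , z))
                                       ⊜ nextᵉ x q₁ q₂ ⊗ᵉ (Κ (+ 2 ∷ []) ⊗ᵉ z)) P.refl xₚ q₁ q₂ z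
  ; denominator = solve 4 (λ x q₁ q₂ z → proj₂ ((cstᵉ (+ 2) *ᵉ yᵉ x) *ᵉ (q₂ , x ⊗ᵉ z) -ᵉ (q₁ , z))
                                         ⊜ (x ⊗ᵉ (x ⊗ᵉ z)) ⊗ᵉ (Κ (+ 2 ∷ []) ⊗ᵉ z)) P.refl xₚ q₁ q₂ z }

U₁-reduced : cst (+ 2) *f yArg ≃ (scaledU 2 , xpow 1)
U₁-reduced = record
  { factor = + 2 ∷ []
  ; factor-nonzero = λ ()
  ; numerator = solve 1 (λ x → proj₁ (cstᵉ (+ 2) *ᵉ yᵉ x) ⊜ nextᵉ x (Κ []) (Κ 1ₚ) ⊗ᵉ Κ (+ 2 ∷ [])) P.refl xₚ
  ; denominator = solve 1 (λ x → proj₂ (cstᵉ (+ 2) *ᵉ yᵉ x) ⊜ (x ⊗ᵉ Κ 1ₚ) ⊗ᵉ Κ (+ 2 ∷ [])) P.refl xₚ }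

U-reduced : ∀ n → proj₁ (Upair yArg n) ≃ (scaledU (suc n) , xpow n)
                × proj₂ (Upair yArg n) ≃ (scaledU (suc (suc n)) , xpow (suc n))
U-reduced zero = ≃-refl , U₁-reduced
U-reduced (suc n) with U-reduced n
... | Uₙ , U₁₊ₙ = U₁₊ₙ , ≃-trans (-f-resp (*f-resp (≃-refl {cst (+ 2) *f yArg}) U₁₊ₙ) Uₙ)
  (U-step-reduced (scaledU (suc n)) (scaledU (suc (suc n))) (xpow n) (xpow-nonzero n))

nextₚ-cong : ∀ {u u′ v v′} → u ≈ₚ u′ → v ≈ₚ v′ → nextₚ u v ≈ₚ nextₚ u′ v′
nextₚ-cong u≈u′ v≈v′ = P.+-cong (P.-‿cong (P.*-congˡ {1ₚ ⊕ xₚ} v≈v′)) (P.-‿cong (P.*-congˡ {xₚ ⊗ xₚ} u≈u′))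

closedForm : ℕ → Poly
closedForm n = (xpow (suc (suc n)) ⊕ neg ((xₚ ⊗ xₚ) ⊗ scaledU (suc n))) ⊕ ((xₚ ⊗ (xₚ ⊗ xₚ)) ⊗ scaledU n)

-- xʲ⁺¹/(1+3x) is a particular solution of the recurrence defining particular.
particular-closed : ∀ n → 1+3x ⊗ particular (suc n) ≈ₚ closedForm n
particular-closed zero =
  solve 1 (λ x → (Aᵉ x ⊗ᵉ Κ []) ⊜ closedᵉ x (Κ 1ₚ) (Κ []) (Κ 1ₚ)) P.refl xₚ
particular-closed (suc zero) =
  solve 1 (λ x → (Aᵉ x ⊗ᵉ ((x ⊗ᵉ (x ⊗ᵉ Κ 1ₚ)) ⊕ᵉ nextᵉ x (Κ []) (Κ [])))
                 ⊜ closedᵉ x (x ⊗ᵉ Κ 1ₚ) (Κ 1ₚ) (nextᵉ x (Κ []) (Κ 1ₚ))) P.refl xₚ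
particular-closed (suc (suc n)) = begin
  1+3x ⊗ (xpow (3 ℕ.+ n) ⊕ nextₚ (particular (suc n)) (particular (2 ℕ.+ n)))
    ≈⟨ solve 4 (λ x w b₀ b₁ → (Aᵉ x ⊗ᵉ ((x ⊗ᵉ (x ⊗ᵉ (x ⊗ᵉ w))) ⊕ᵉ nextᵉ x b₀ b₁))
                             ⊜ ((Aᵉ x ⊗ᵉ (x ⊗ᵉ (x ⊗ᵉ (x ⊗ᵉ w)))) ⊕ᵉ nextᵉ x (Aᵉ x ⊗ᵉ b₀) (Aᵉ x ⊗ᵉ b₁)))
         P.refl xₚ (xpow n) (particular (suc n)) (particular (2 ℕ.+ n)) ⟩
  (1+3x ⊗ xpow (3 ℕ.+ n)) ⊕ nextₚ (1+3x ⊗ particular (suc n)) (1+3x ⊗ particular (2 ℕ.+ n))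
    ≈⟨ P.+-congˡ {1+3x ⊗ xpow (3 ℕ.+ n)} (nextₚ-cong (particular-closed n) (particular-closed (suc n))) ⟩
  (1+3x ⊗ xpow (3 ℕ.+ n)) ⊕ nextₚ (closedForm n) (closedForm (suc n))
    ≈⟨ solve 4 (λ x w q₀ q₁ → ((Aᵉ x ⊗ᵉ (x ⊗ᵉ (x ⊗ᵉ (x ⊗ᵉ w))))
                                ⊕ᵉ nextᵉ x (closedᵉ x w q₀ q₁) (closedᵉ x (x ⊗ᵉ w) q₁ (nextᵉ x q₀ q₁)))
                             ⊜ closedᵉ x (x ⊗ᵉ (x ⊗ᵉ w)) (nextᵉ x q₀ q₁) (nextᵉ x q₁ (nextᵉ x q₀ q₁)))
         P.refl xₚ (xpow n) (scaledU n) (scaledU (suc n)) ⟩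
  closedForm (suc (suc n)) ∎
  where open SetoidReasoning P.setoid

Aᶠ : Frac
Aᶠ = cst (+ 1) +f (cst (+ 3) *f X)

rhsOf : ℕ → Frac → Frac → Frac
rhsOf k u u′ = invf ((cst (+ 1) -f ((cst (+ k) *f X) /f Aᶠ))
                     -f (((cst (+ 2) *f (X *f X)) /f (Aᶠ *f Aᶠ)) *f (((u -f u′) -f cst (+ 1)) /f u)))

rhsOf-resp : ∀ k {u v u′ v′} → u ≃ v → u′ ≃ v′ → rhsOf k u u′ ≃ rhsOf k v v′
rhsOf-resp k u≃v u′≃v′ = invf-resp (-f-resp (≃-refl {cst (+ 1) -f ((cst (+ k) *f X) /f Aᶠ)})
  (*f-resp (≃-refl {(cst (+ 2) *f (X *f X)) /f (Aᶠ *f Aᶠ)})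
           (/f-resp (-f-resp (-f-resp u≃v u′≃v′) (≃-refl {cst (+ 1)})) u≃v)))

closedNumerator : ℕ → Poly
closedNumerator k = ((1+3x ⊗ d₀ k) ⊕ neg (1+3x ⊗ ((+ k ∷ []) ⊗ (xₚ ⊗ (xₚ ⊗ scaledU (suc k))))))
                    ⊕ ((+ 2 ∷ []) ⊗ (xₚ ⊗ closedForm k))

1+3x-n₀ : ∀ k → 1+3x ⊗ n₀ k ≈ₚ closedNumerator k
1+3x-n₀ k = P.trans (distribute 1+3x (d₀ k) ((+ k ∷ []) ⊗ (xₚ ⊗ (xₚ ⊗ scaledU (suc k)))) xₚ (particular (suc k)))
  (P.+-congˡ {(1+3x ⊗ d₀ k) ⊕ neg (1+3x ⊗ ((+ k ∷ []) ⊗ (xₚ ⊗ (xₚ ⊗ scaledU (suc k)))))}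
             (P.*-congˡ {+ 2 ∷ []} (P.*-congˡ {xₚ} (particular-closed k))))
  where
  distribute : ∀ a d e x b → a ⊗ ((d ⊕ neg e) ⊕ ((+ 2 ∷ []) ⊗ (x ⊗ b)))
                             ≈ₚ ((a ⊗ d) ⊕ neg (a ⊗ e)) ⊕ ((+ 2 ∷ []) ⊗ (x ⊗ (a ⊗ b)))
  distribute = solve-∀ PolyACR

rhsOf-reduced : ∀ j → rhsOf (suc j) (scaledU (2 ℕ.+ j) , xpow (suc j)) (scaledU (suc j) , xpow j)
                        ≃ (1+3x ⊗ d₀ (suc j) , closedNumerator (suc j))
rhsOf-reduced j = record
  { factor = 1+3x ⊗ (xpow j ⊗ xpow j)
  ; factor-nonzero = ⊗-nonzeroAt1 1+3x (xpow j ⊗ xpow j) (λ ()) (⊗-nonzeroAt1 (xpow j) (xpow j) (xpow-nonzero j) (xpow-nonzero j))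
  ; numerator = solve 5 (λ x K q₁ q₂ z → proj₁ (rhsᵉ x K (q₂ , x ⊗ᵉ z) (q₁ , z))
      ⊜ (Aᵉ x ⊗ᵉ (Aᵉ x ⊗ᵉ (x ⊗ᵉ q₂))) ⊗ᵉ (Aᵉ x ⊗ᵉ (z ⊗ᵉ z)))
      P.refl xₚ (+ suc j ∷ []) (scaledU (suc j)) (scaledU (2 ℕ.+ j)) (xpow j)
  ; denominator = solve 5 (λ x K q₁ q₂ z → proj₂ (rhsᵉ x K (q₂ , x ⊗ᵉ z) (q₁ , z))
      ⊜ (((Aᵉ x ⊗ᵉ (Aᵉ x ⊗ᵉ (x ⊗ᵉ q₂))) ⊕ᵉ ⊝ᵉ (Aᵉ x ⊗ᵉ (K ⊗ᵉ (x ⊗ᵉ (x ⊗ᵉ q₂)))))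
          ⊕ᵉ (Κ (+ 2 ∷ []) ⊗ᵉ (x ⊗ᵉ closedᵉ x (x ⊗ᵉ z) q₁ q₂))) ⊗ᵉ (Aᵉ x ⊗ᵉ (z ⊗ᵉ z)))
      P.refl xₚ (+ suc j ∷ []) (scaledU (suc j)) (scaledU (2 ℕ.+ j)) (xpow j) }

≃-by-factor : ∀ s {a b a′ b′} → NonzeroAt1 s → a′ ≈ₚ s ⊗ a → b′ ≈ₚ s ⊗ b → (a′ , b′) ≃ (a , b)
≃-by-factor s {a} {b} s≠0 a′≈sa b′≈sb = record
  { factor = s ; factor-nonzero = s≠0
  ; numerator = P.trans a′≈sa (P.*-comm s a) ; denominator = P.trans b′≈sb (P.*-comm s b) }

rhs-reduced : ∀ j → rhs (suc j) ≃ (d₀ (suc j) , n₀ (suc j))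
rhs-reduced j = ≃-trans (rhsOf-resp (suc j) (proj₂ (U-reduced j)) (proj₁ (U-reduced j)))
  (≃-trans (rhsOf-reduced j) (≃-by-factor 1+3x (λ ()) P.refl (P.sym (1+3x-n₀ (suc j)))))

alternating : ℕ → ℤ
alternating zero = - + 1
alternating (suc n) = - alternating n

alternating-nonzero : ∀ n → alternating n ≢ + 0
alternating-nonzero zero ()
alternating-nonzero (suc n) e = alternating-nonzero n (trans (sym (ℤ.neg-involutive _)) (cong -_ e))

sumℤ-next : ∀ u v → sumℤ (nextₚ u v) ≡ - + 1 * (+ 2 * sumℤ v) + - + 1 * (+ 1 * sumℤ u)
sumℤ-next u v = trans (sumℤ-⊕ (neg ((1ₚ ⊕ xₚ) ⊗ v)) (neg ((xₚ ⊗ xₚ) ⊗ u)))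
  (cong₂ _+_ (trans (sumℤ-scale (- + 1) ((1ₚ ⊕ xₚ) ⊗ v)) (cong (_*_ (- + 1)) (sumℤ-⊗ (1ₚ ⊕ xₚ) v)))
             (trans (sumℤ-scale (- + 1) ((xₚ ⊗ xₚ) ⊗ u)) (cong (_*_ (- + 1)) (sumℤ-⊗ (xₚ ⊗ xₚ) u))))

scaledU-at-1 : ∀ n → sumℤ (scaledU n) ≡ alternating n * + n
scaledU-at-1 zero = refl
scaledU-at-1 (suc zero) = refl
scaledU-at-1 (suc (suc n)) =
  trans (sumℤ-next (scaledU n) (scaledU (suc n)))
  (trans (cong₂ (λ a b → - + 1 * (+ 2 * b) + - + 1 * (+ 1 * a)) (scaledU-at-1 n) (scaledU-at-1 (suc n)))
         (recurrence-at-1 (alternating n) (+ n)))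
  where
  recurrence-at-1 : ∀ s m → - + 1 * (+ 2 * (- s * (+ 1 + m))) + - + 1 * (+ 1 * (s * m)) ≡ - - s * (+ 2 + m)
  recurrence-at-1 = ℤ-Solver.solve-∀

scaledU-nonzero : ∀ n → NonzeroAt1 (scaledU (suc n))
scaledU-nonzero n e with ℤ.i*j≡0⇒i≡0∨j≡0 (alternating (suc n)) (trans (sym (scaledU-at-1 (suc n))) e)
... | inj₁ alt≡0 = alternating-nonzero (suc n) alt≡0
... | inj₂ ()

d₀-nonzero : ∀ k → NonzeroAt1 (d₀ k)
d₀-nonzero k =
  ⊗-nonzeroAt1 1+3x (xₚ ⊗ scaledU (suc k)) (λ ()) (⊗-nonzeroAt1 xₚ (scaledU (suc k)) (λ ()) (scaledU-nonzero k))

◃-multiple : ∀ {D N n d} F f → D ≈ₚ n ⊗ F → N ≈ₚ d ⊗ F → n ◃ f ≐ coeff d → D ◃ f ≐ coeff N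
◃-multiple {D} {N} {n} {d} F f D≈nF N≈dF n◃f≐d = begin
  D ◃ f            ≈⟨ ◃-congˡ (P.trans D≈nF (P.*-comm n F)) f ⟩
  (F ⊗ n) ◃ f      ≈⟨ ⊗-◃ F n f ⟩
  F ◃ (n ◃ f)      ≈⟨ ◃-congʳ F n◃f≐d ⟩
  F ◃ coeff d      ≈⟨ coeff-⊗ F d ⟨
  coeff (F ⊗ d)    ≈⟨ coeff-≐ (P.trans (P.*-comm F d) (P.sym N≈dF)) ⟩
  coeff N          ∎
  where open ≐-Reasoning

nonzero-coefficient : ∀ {D N} f → D ◃ f ≐ coeff N → NonzeroAt1 N → Σ ℕ (λ i → coeff D i ≢ + 0)
nonzero-coefficient {D} {N} f D◃f≐N N≠0 with coeffs-vanish-or-witness D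
... | inj₂ witness = witness
... | inj₁ D≈[] = ⊥-elim (N≠0 (sumℤ-cong {N} {[]} (coeffwise (≐-trans (≐-sym D◃f≐N) (◃-congˡ D≈[] f)))))

mainTheorem2 : (k : ℕ) → 2 ≤ k →
    (Σ ℕ (λ i → coeff (proj₂ (rhs k)) i ≢ + 0))
    × ((n : ℕ) → convCoeff (proj₂ (rhs k)) (λ m → + (h k m)) n ≡ coeff (proj₁ (rhs k)) n)
mainTheorem2 zero ()
mainTheorem2 (suc j) _ =
  nonzero-coefficient {proj₂ (rhs k)} {proj₁ (rhs k)} Hₛ generating-function
    (≈ₚ-nonzeroAt1 numerator (⊗-nonzeroAt1 (d₀ k) factor (d₀-nonzero k) factor-nonzero)) ,
  λ n → trans (convCoeff-◃ (proj₂ (rhs k)) Hₛ n) (at generating-function n)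
  where
  k : ℕ
  k = suc j
  open _≃_ (rhs-reduced j)
  open GeneratingFunction k using (Hₛ; n₀-◃-H)
  generating-function : proj₂ (rhs k) ◃ Hₛ ≐ coeff (proj₁ (rhs k))
  generating-function =
    ◃-multiple {proj₂ (rhs k)} {proj₁ (rhs k)} {n₀ k} {d₀ k} factor Hₛ denominator numerator n₀-◃-H
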